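{- Let $n,t\in\mathbb{N}$. Let $F$ be an $n$-vertex $2$-regular graph all of whose vertices belong to cycles of length at least $30$. Let $n_1,\dots,n_t\in\mathbb{N}$ satisfy $\sum_{i\in[t]}n_i=n$ and $n_i\geq50$ for all $i\in[t]$. Then there exists a map $f:V(F)\to[t]$ such that: (i) $|f^{ -1}(i)|=n_i$ for all $i\in[t]$; (ii) $|f(x)-f(y)|\leq1$ for all $xy\in E(F)$; (iii) the set $E$ of all edges $xy\in E(F)$ with $f(x)\neq f(y)$ is an induced matching in $F$; (iv) for all $i\in[t-1]$ there are exactly four edges $xy\in E(F)$ with $\{f(x),f(y)\}=\{i,i+1\}$. -}

module Defs where

open import Data.Nat using (ℕ; zero; suc; _+_; _≤_; _<_)
open import Data.Bool using (Bool; true; false; _∧_; if_then_else_)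
open import Data.Fin using (Fin; toℕ)
open import Data.Fin.Properties using () renaming (_≟_ to _≟ᶠ_)
open import Data.Nat.Properties using (_≟_)
open import Data.Product using (Σ; _×_; ∃; ∃-syntax)
open import Function.Definitions using (Injective)
open import Relation.Nullary using (¬_)
open import Relation.Nullary.Decidable using (⌊_⌋)
open import Relation.Binary.PropositionalEquality using (_≡_)

record Graph (n : ℕ) : Set where
  field
    adj   : Fin n → Fin n → Bool
    sym   : ∀ x y → adj x y ≡ adj y x
    irrefl : ∀ x → adj x x ≡ false
open Graph public

Adj : ∀ {n} → Graph n → Fin n → Fin n → Set
Adj G x y = adj G x y ≡ true

count : ∀ n → (Fin n → Bool) → ℕ
count zero    P = 0
count (suc n) P = (if P Fin.zero then 1 else 0) + count n (λ i → P (Fin.suc i))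

sumFin : ∀ t → (Fin t → ℕ) → ℕ
sumFin zero    a = 0
sumFin (suc t) a = a Fin.zero + sumFin t (λ i → a (Fin.suc i))

degree : ∀ {n} → Graph n → Fin n → ℕ
degree {n} G x = count n (adj G x)

TwoRegular : ∀ {n} → Graph n → Set
TwoRegular G = ∀ x → degree G x ≡ 2

cycSucc : ∀ {k} → Fin k → Fin k
cycSucc {suc k} i with Data.Nat._<?_ (suc (toℕ i)) (suc k)
... | Relation.Nullary.yes p = Data.Fin.fromℕ< p
... | Relation.Nullary.no _  = Fin.zero
  where import Data.Nat
        import Relation.Nullary

IsCycle : ∀ {n} → Graph n → (k : ℕ) → (Fin k → Fin n) → Set
IsCycle G k c = 3 ≤ k × Injective _≡_ _≡_ c × (∀ i → Adj G (c i) (c (cycSucc i)))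

OnCycleOfLengthAtLeast : ∀ {n} → Graph n → ℕ → Fin n → Set
OnCycleOfLengthAtLeast {n} G m x =
  Σ ℕ λ k → m ≤ k × Σ (Fin k → Fin n) λ c → IsCycle G k c × ∃[ i ] c i ≡ x

-- the set of edges xy with f x ≠ f y is an induced matching in G:
-- whenever xy and uv are two such edges (oriented) and u = x or u is
-- adjacent to x, then {u,v} = {x,y} (same edge).
CrossEdgesInducedMatching : ∀ {n t} → Graph n → (Fin n → Fin t) → Set
CrossEdgesInducedMatching G f =
  ∀ x y u v → Adj G x y → ¬ f x ≡ f y → Adj G u v → ¬ f u ≡ f v →
  (u ≡ x Data.Sum.⊎ Adj G x u) →
  (u ≡ x × v ≡ y) Data.Sum.⊎ (u ≡ y × v ≡ x)
  where import Data.Sum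

-- number of edges xy of G with {f x, f y} = {i, i+1}
-- (each such edge counted once, via its orientation f x = i, f y = i+1)
edgesBetween : ∀ {n t} → Graph n → (Fin n → Fin t) → ℕ → ℕ
edgesBetween {n} G f i =
  sumFin n λ x → count n λ y →
    adj G x y ∧ ⌊ toℕ (f x) ≟ i ⌋ ∧ ⌊ toℕ (f y) ≟ suc i ⌋

module Submission where

-- Lay the cycles C₁,…,C_m of F out one after the other on the positions
-- 0,…,N-1 (N = n), listing each cycle c₀,…,c_{K-1} in zigzag order
-- c₀, c₁, c_{K-1}, c₂, c_{K-2}, … .  In this "position model" two positions are
-- adjacent iff they lie in the same segment and differ by 2, or they are the
-- first two (or the last two) positions of a segment.  Call a position c
-- "good" if it lies at distance ≥ 4 from both ends of its segment: exactly two
-- edges jump over a good c, and none of length 1.  Since segments have length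
-- ≥ 30, every interval [p+8, p+16] contains a good position.
--
-- The labelling uses nested windows [a₁,b₁) ⊃ … ⊃ [a_{t-1},b_{t-1}) with good
-- endpoints, consecutive endpoints at least 8 apart; a position is labelled by
-- the number of windows containing it, so part q (q = 0,…,t-1) consists of the
-- positions inside exactly q windows.  Window q has length n_q + … + n_{t-1},
-- its endpoints chosen greedily among the good positions.  Then (i) part q has
-- n_q elements; (ii) adjacent positions are ≤ 2 apart, so their labels differ
-- by ≤ 1; (iii) crossing edges jump over cuts, distinct cuts are ≥ 8 apart and
-- the two edges over one good cut do not touch, so crossing edges form an
-- induced matching; (iv) parts q and q+1 meet exactly at the two cuts a_{q+1},
-- b_{q+1}, each jumped over by two edges.

open import Defs hiding (sym)
open import Data.Nat using (ℕ; zero; suc; _+_; _*_; _∸_; _≤_; _<_; z≤n; s≤s; _≤?_; _<?_)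
open import Data.Nat.Properties renaming (_≟_ to _≟ℕ_)
open import Data.Bool using (Bool; true; false; _∧_; _∨_)
open import Data.List using (List; []; _∷_; length)
open import Data.Nat.ListAction using (sum)
open import Data.List.Relation.Unary.All using (All; []; _∷_)
open import Data.Fin using (Fin; toℕ; fromℕ<; fromℕ; inject₁)
import Data.Fin as Fin
open import Data.Fin.Properties using (_≟_; toℕ-injective; toℕ<n; toℕ-fromℕ<; fromℕ<-toℕ; toℕ-fromℕ; toℕ-inject₁; any?)
open import Data.Fin.Permutation using (Permutation; permutation; _⟨$⟩ʳ_)
import Data.Fin.Permutation as Perm
open import Data.Product using (Σ; _×_; _,_; proj₁; proj₂)
open import Data.Sum using (_⊎_; inj₁; inj₂)
open import Data.Empty using (⊥; ⊥-elim)
open import Data.Unit using (⊤; tt)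
open import Function.Definitions using (Injective)
open import Relation.Nullary using (¬_; Dec; yes; no)
open import Relation.Nullary.Decidable using (⌊_⌋; True; toWitness)
open import Relation.Binary.PropositionalEquality
open import Relation.Binary.Definitions using (tri<; tri≈; tri>)
open import Algebra.Properties.CommutativeSemigroup +-commutativeSemigroup using (interchange)
import Algebra.Properties.CommutativeMonoid.Sum as MonoidSum

module Sums where

  ind : Bool → ℕ
  ind true = 1
  ind false = 0

  ind≤1 : ∀ b → ind b ≤ 1
  ind≤1 true = ≤-refl
  ind≤1 false = z≤n

  ind-∧ : ∀ b c → ind (b ∧ c) ≡ ind b * ind c
  ind-∧ true c = sym (+-identityʳ (ind c))
  ind-∧ false c = refl

  ind-∨ : ∀ x y → ind x + ind y ≤ 1 → ind (x ∨ y) ≡ ind x + ind y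
  ind-∨ true true (s≤s ())
  ind-∨ true false _ = refl
  ind-∨ false y _ = refl

  bool-ext : ∀ {x y} → (x ≡ true → y ≡ true) → (y ≡ true → x ≡ true) → x ≡ y
  bool-ext {true} {true} _ _ = refl
  bool-ext {true} {false} x⇒y _ = sym (x⇒y refl)
  bool-ext {false} {true} _ y⇒x = y⇒x refl
  bool-ext {false} {false} _ _ = refl

  -- Reading a decision procedure as a Boolean via ⌊_⌋ (isYes, unlike the
  -- library lemmas about does).
  dec-true : ∀ {P : Set} (d : Dec P) → P → ⌊ d ⌋ ≡ true
  dec-true (yes _) _ = refl
  dec-true (no ¬p) p = ⊥-elim (¬p p)

  dec-sound : ∀ {P : Set} (d : Dec P) → ⌊ d ⌋ ≡ true → P
  dec-sound (yes p) _ = p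

  eqℕ : ℕ → ℕ → Bool
  eqℕ a b = ⌊ a ≟ℕ b ⌋

  eqℕ-true : ∀ {a b} → a ≡ b → eqℕ a b ≡ true
  eqℕ-true {a} {b} = dec-true (a ≟ℕ b)

  eqℕ-sound : ∀ {a b} → eqℕ a b ≡ true → a ≡ b
  eqℕ-sound {a} {b} = dec-sound (a ≟ℕ b)

  eqℕ-false : ∀ {a b} → a ≢ b → eqℕ a b ≡ false
  eqℕ-false {a} {b} a≢b with a ≟ℕ b
  ... | yes a≡b = ⊥-elim (a≢b a≡b)
  ... | no _ = refl

  eqℕ-+ : ∀ k a b → eqℕ (k + a) (k + b) ≡ eqℕ a b
  eqℕ-+ k a b with a ≟ℕ b
  ... | yes refl = eqℕ-true refl
  ... | no a≢b = eqℕ-false (λ e → a≢b (+-cancelˡ-≡ k a b e))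

  eqℕ-suc : ∀ a b → eqℕ (suc a) (suc b) ≡ eqℕ a b
  eqℕ-suc = eqℕ-+ 1

  eqFin-toℕ : ∀ {n} (x a : Fin n) → ⌊ x ≟ a ⌋ ≡ eqℕ (toℕ x) (toℕ a)
  eqFin-toℕ x a with x ≟ a
  ... | yes refl = sym (eqℕ-true refl)
  ... | no x≢a = sym (eqℕ-false (λ e → x≢a (toℕ-injective e)))

  -- Σ_{i<n} h i.  Positions of the model are natural numbers, so most sums
  -- range over an initial segment of ℕ.
  sumBelow : ℕ → (ℕ → ℕ) → ℕ
  sumBelow zero h = 0
  sumBelow (suc n) h = h 0 + sumBelow n (λ i → h (suc i))

  sumBelow-cong : ∀ n {g h : ℕ → ℕ} → (∀ i → i < n → g i ≡ h i) → sumBelow n g ≡ sumBelow n h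
  sumBelow-cong zero e = refl
  sumBelow-cong (suc n) e = cong₂ _+_ (e 0 (s≤s z≤n)) (sumBelow-cong n (λ i i<n → e (suc i) (s≤s i<n)))

  sumBelow-+ : ∀ n (g h : ℕ → ℕ) → sumBelow n (λ i → g i + h i) ≡ sumBelow n g + sumBelow n h
  sumBelow-+ zero g h = refl
  sumBelow-+ (suc n) g h =
    trans (cong (g 0 + h 0 +_) (sumBelow-+ n (λ i → g (suc i)) (λ i → h (suc i))))
          (interchange (g 0) (h 0) _ _)

  sumBelow-split : ∀ m k (h : ℕ → ℕ) → sumBelow (m + k) h ≡ sumBelow m h + sumBelow k (λ i → h (m + i))
  sumBelow-split zero k h = refl
  sumBelow-split (suc m) k h =
    trans (cong (h 0 +_) (sumBelow-split m k (λ i → h (suc i)))) (sym (+-assoc (h 0) _ _))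

  sumBelow-zero : ∀ n (h : ℕ → ℕ) → (∀ i → i < n → h i ≡ 0) → sumBelow n h ≡ 0
  sumBelow-zero zero h e = refl
  sumBelow-zero (suc n) h e rewrite e 0 (s≤s z≤n) = sumBelow-zero n _ (λ i i<n → e (suc i) (s≤s i<n))

  sumBelow-one : ∀ n (h : ℕ → ℕ) → (∀ i → i < n → h i ≡ 1) → sumBelow n h ≡ n
  sumBelow-one zero h e = refl
  sumBelow-one (suc n) h e rewrite e 0 (s≤s z≤n) = cong suc (sumBelow-one n _ (λ i i<n → e (suc i) (s≤s i<n)))

  sumBelow-swap : ∀ n m (g : ℕ → ℕ → ℕ) →
    sumBelow n (λ i → sumBelow m (λ j → g i j)) ≡ sumBelow m (λ j → sumBelow n (λ i → g i j))
  sumBelow-swap zero m g = sym (sumBelow-zero m _ (λ _ _ → refl))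
  sumBelow-swap (suc n) m g =
    trans (cong (sumBelow m (λ j → g 0 j) +_) (sumBelow-swap n m (λ i j → g (suc i) j)))
          (sym (sumBelow-+ m (λ j → g 0 j) (λ j → sumBelow n (λ i → g (suc i) j))))

  sumBelow-delta : ∀ n c (w : ℕ → ℕ) → c < n → sumBelow n (λ i → ind (eqℕ i c) * w i) ≡ w c
  sumBelow-delta (suc n) zero w _ =
    trans (cong₂ _+_ (+-identityʳ (w 0)) (sumBelow-zero n _ (λ _ _ → refl))) (+-identityʳ (w 0))
  sumBelow-delta (suc n) (suc c) w (s≤s c<n) =
    trans (sumBelow-cong n (λ i _ → cong (λ b → ind b * w (suc i)) (eqℕ-suc i c)))
          (sumBelow-delta n c (λ i → w (suc i)) c<n)

  sumBelow-delta-if : ∀ n (A : Bool) c (w : ℕ → ℕ) → (A ≡ true → c < n) →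
    sumBelow n (λ i → ind (A ∧ eqℕ i c) * w i) ≡ ind A * w c
  sumBelow-delta-if n false c w _ = sumBelow-zero n _ (λ _ _ → refl)
  sumBelow-delta-if n true c w c<n = trans (sumBelow-delta n c w (c<n refl)) (sym (+-identityʳ (w c)))

  sumBelow-count-shift : ∀ k n a → k ≤ a → a < k + n → sumBelow n (λ i → ind (eqℕ (k + i) a)) ≡ 1
  sumBelow-count-shift k n a k≤a a<k+n with m≤n⇒∃[o]m+o≡n k≤a
  ... | a' , refl =
    trans (sumBelow-cong n (λ i _ → trans (sym (*-identityʳ _)) (cong (λ b → ind b * 1) (eqℕ-+ k i a'))))
          (sumBelow-delta n a' (λ _ → 1) (+-cancelˡ-< k a' n a<k+n))

  sumFin-toℕ : ∀ n (h : ℕ → ℕ) → sumFin n (λ i → h (toℕ i)) ≡ sumBelow n h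
  sumFin-toℕ zero h = refl
  sumFin-toℕ (suc n) h = cong (h 0 +_) (sumFin-toℕ n (λ i → h (suc i)))

  sumFin-cong : ∀ n {g h : Fin n → ℕ} → (∀ x → g x ≡ h x) → sumFin n g ≡ sumFin n h
  sumFin-cong zero e = refl
  sumFin-cong (suc n) e = cong₂ _+_ (e Fin.zero) (sumFin-cong n (λ x → e (Fin.suc x)))

  sumFin-+ : ∀ n (g h : Fin n → ℕ) → sumFin n (λ x → g x + h x) ≡ sumFin n g + sumFin n h
  sumFin-+ zero g h = refl
  sumFin-+ (suc n) g h =
    trans (cong (g Fin.zero + h Fin.zero +_) (sumFin-+ n (λ x → g (Fin.suc x)) (λ x → h (Fin.suc x))))
          (interchange (g Fin.zero) (h Fin.zero) _ _)

  sumFin-mono : ∀ n {g h : Fin n → ℕ} → (∀ x → g x ≤ h x) → sumFin n g ≤ sumFin n h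
  sumFin-mono zero le = z≤n
  sumFin-mono (suc n) le = +-mono-≤ (le Fin.zero) (sumFin-mono n (λ x → le (Fin.suc x)))

  count-sumFin : ∀ n (P : Fin n → Bool) → count n P ≡ sumFin n (λ x → ind (P x))
  count-sumFin zero P = refl
  count-sumFin (suc n) P with P Fin.zero
  ... | true = cong suc (count-sumFin n (λ i → P (Fin.suc i)))
  ... | false = count-sumFin n (λ i → P (Fin.suc i))

  sumFin-delta : ∀ n (a : Fin n) → sumFin n (λ x → ind ⌊ x ≟ a ⌋) ≡ 1
  sumFin-delta n a =
    trans (sumFin-cong n (λ x → trans (cong ind (eqFin-toℕ x a)) (sym (*-identityʳ _))))
          (trans (sumFin-toℕ n (λ i → ind (eqℕ i (toℕ a)) * 1)) (sumBelow-delta n (toℕ a) (λ _ → 1) (toℕ<n a)))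

  module ℕ-Sum = MonoidSum +-0-commutativeMonoid

  sum≡sumFin : ∀ n (g : Fin n → ℕ) → ℕ-Sum.sum g ≡ sumFin n g
  sum≡sumFin zero g = refl
  sum≡sumFin (suc n) g = cong (g Fin.zero +_) (sum≡sumFin n (λ i → g (Fin.suc i)))

  sumFin-permute : ∀ {m n} (g : Fin n → ℕ) (π : Permutation m n) →
    sumFin n g ≡ sumFin m (λ p → g (π ⟨$⟩ʳ p))
  sumFin-permute {m} {n} g π =
    trans (sym (sum≡sumFin n g)) (trans (ℕ-Sum.sum-permute g π) (sum≡sumFin m _))

open Sums

module Arith where

  ≤-lit : ∀ m n → {w : True (m ≤? n)} → m ≤ n
  ≤-lit m n {w} = toWitness w

  1+k+n≰n : ∀ k n → suc k + n ≤ n → ⊥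
  1+k+n≰n = m+n≮n

  1+k+n≢n : ∀ k n → suc k + n ≡ n → ⊥
  1+k+n≢n k n e = m≢1+n+m n (sym e)

  1+c+[a+b]≰a : ∀ a b c → suc (c + (a + b)) ≤ a → ⊥
  1+c+[a+b]≰a a b c h = m+n≮n c a (≤-trans (s≤s (+-monoʳ-≤ c (m≤m+n a b))) h)

  +-exchange : ∀ k L x → k + (L + x) ≡ L + (k + x)
  +-exchange k L x = trans (sym (+-assoc k L x)) (trans (cong (_+ x) (+-comm k L)) (+-assoc L k x))

  ≤⇒shift : ∀ L x → L ≤ x → Σ ℕ (λ x' → x ≡ L + x')
  ≤⇒shift L x L≤x = x ∸ L , sym (m+[n∸m]≡n L≤x)

  between : ∀ s a → s < a → a ≤ 2 + s → a ≡ suc s ⊎ a ≡ 2 + s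
  between s a s<a a≤2+s with m≤n⇒m<n∨m≡n a≤2+s
  ... | inj₂ e = inj₂ e
  ... | inj₁ a<2+s = inj₁ (≤-antisym (≤-pred a<2+s) s<a)

open Arith

-- A list Ls of segment lengths describes the positions
-- 0,…,sum Ls - 1, cut into consecutive segments of the given lengths; a cycle of
-- length K laid out in zigzag order occupies a segment of length K.
module Model where

  Long : List ℕ → Set
  Long = All (30 ≤_)

  -- Good Ls c: the cut just before position c is deep inside a segment, i.e.
  -- c is at distance at least 4 from both ends of its segment.
  Good : List ℕ → ℕ → Set
  Good [] c = ⊥
  Good (L ∷ Ls) c = (4 ≤ c × 4 + c ≤ L) ⊎ Σ ℕ (λ c' → c ≡ L + c' × Good Ls c')

  E2 : List ℕ → ℕ → Set
  E2 [] p = ⊥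
  E2 (L ∷ Ls) p = (3 + p ≤ L) ⊎ Σ ℕ (λ p' → p ≡ L + p' × E2 Ls p')

  E1 : List ℕ → ℕ → Set
  E1 [] p = ⊥
  E1 (L ∷ Ls) p = (2 + p ≤ L × (p ≡ 0 ⊎ 2 + p ≡ L)) ⊎ Σ ℕ (λ p' → p ≡ L + p' × E1 Ls p')

  MAdj : List ℕ → ℕ → ℕ → Set
  MAdj Ls p p' = (E2 Ls p × p' ≡ 2 + p) ⊎ (E2 Ls p' × p ≡ 2 + p')
               ⊎ (E1 Ls p × p' ≡ suc p) ⊎ (E1 Ls p' × p ≡ suc p')

  Good-4≤ : ∀ Ls c → Good Ls c → 4 ≤ c
  Good-4≤ (L ∷ Ls) c (inj₁ (h , _)) = h
  Good-4≤ (L ∷ Ls) c (inj₂ (c' , refl , g)) = ≤-trans (Good-4≤ Ls c' g) (m≤n+m c' L)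

  Good-bound : ∀ Ls c → Good Ls c → 4 + c ≤ sum Ls
  Good-bound (L ∷ Ls) c (inj₁ (_ , h)) = ≤-trans h (m≤m+n L (sum Ls))
  Good-bound (L ∷ Ls) c (inj₂ (c' , refl , g)) =
    subst (_≤ L + sum Ls) (sym (+-exchange 4 L c')) (+-monoʳ-≤ L (Good-bound Ls c' g))

  E2-bound : ∀ Ls p → E2 Ls p → 3 + p ≤ sum Ls
  E2-bound (L ∷ Ls) p (inj₁ h) = ≤-trans h (m≤m+n L (sum Ls))
  E2-bound (L ∷ Ls) p (inj₂ (p' , refl , g)) =
    subst (_≤ L + sum Ls) (sym (+-exchange 3 L p')) (+-monoʳ-≤ L (E2-bound Ls p' g))

  E1-bound : ∀ Ls p → E1 Ls p → 2 + p ≤ sum Ls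
  E1-bound (L ∷ Ls) p (inj₁ (h , _)) = ≤-trans h (m≤m+n L (sum Ls))
  E1-bound (L ∷ Ls) p (inj₂ (p' , refl , g)) =
    subst (_≤ L + sum Ls) (sym (+-exchange 2 L p')) (+-monoʳ-≤ L (E1-bound Ls p' g))

  shift-suc : ∀ L p' c' → suc (L + p') ≡ L + c' → c' ≡ suc p'
  shift-suc L p' c' e = sym (+-cancelˡ-≡ L _ _ (trans (+-suc L p') e))

  E1-notGood : ∀ Ls → Long Ls → ∀ p → E1 Ls p → ¬ Good Ls (suc p)
  E1-notGood (L ∷ Ls) (30≤L ∷ _) .0 (inj₁ (_ , inj₁ refl)) (inj₁ (s≤s () , _))
  E1-notGood (L ∷ Ls) (30≤L ∷ _) .0 (inj₁ (_ , inj₁ refl)) (inj₂ (c' , e , _)) =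
    1+k+n≰n 28 1 (≤-trans 30≤L (subst (L ≤_) (sym e) (m≤m+n L c')))
  E1-notGood (L ∷ Ls) _ p (inj₁ (_ , inj₂ refl)) (inj₁ (_ , s≤s (s≤s h))) = 1+k+n≰n 2 p h
  E1-notGood (L ∷ Ls) _ p (inj₁ (_ , inj₂ refl)) (inj₂ (c' , e , _)) =
    1+c+[a+b]≰a p c' 0 (≤-reflexive (sym (suc-injective e)))
  E1-notGood (L ∷ Ls) _ p (inj₂ (p' , refl , _)) (inj₁ (_ , h)) = 1+c+[a+b]≰a L p' 4 h
  E1-notGood (L ∷ Ls) (_ ∷ long) p (inj₂ (p' , refl , e1)) (inj₂ (c' , e , g)) =
    E1-notGood Ls long p' e1 (subst (Good Ls) (shift-suc L p' c' e) g)

  Good-near : ∀ Ls c → Good Ls c → ∀ x → c ≤ 2 + x → x ≤ suc c → E2 Ls x × ¬ E1 Ls x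
  Good-near (L ∷ Ls) c (inj₁ (4≤c , c+4≤L)) x c≤2+x x≤1+c =
    inj₁ (≤-trans (+-monoʳ-≤ 3 x≤1+c) c+4≤L) , notE1
    where
    notE1 : ¬ E1 (L ∷ Ls) x
    notE1 (inj₁ (_ , inj₁ refl)) = 1+k+n≰n 1 2 (≤-trans 4≤c c≤2+x)
    notE1 (inj₁ (_ , inj₂ e)) =
      1+k+n≰n 0 (3 + c) (≤-trans c+4≤L (≤-trans (≤-reflexive (sym e)) (+-monoʳ-≤ 2 x≤1+c)))
    notE1 (inj₂ (x' , refl , _)) = 1+k+n≰n 2 (suc c) (≤-trans c+4≤L (≤-trans (m≤m+n L x') x≤1+c))
  Good-near (L ∷ Ls) c (inj₂ (c' , refl , g)) x c≤2+x x≤1+c with ≤⇒shift L x L≤x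
    where
    L≤x : L ≤ x
    L≤x = ≤-trans (m≤n+m L 2) (≤-pred (≤-pred (≤-trans (≤-reflexive (+-comm 4 L))
           (≤-trans (+-monoʳ-≤ L (Good-4≤ Ls c' g)) c≤2+x))))
  ... | x' , refl with Good-near Ls c' g x'
         (+-cancelˡ-≤ L _ _ (≤-trans c≤2+x (≤-reflexive (+-exchange 2 L x'))))
         (+-cancelˡ-≤ L _ _ (≤-trans x≤1+c (≤-reflexive (sym (+-suc L c')))))
  ... | e2 , notE1' = inj₂ (x' , refl , e2) , notE1
    where
    notE1 : ¬ E1 (L ∷ Ls) (L + x')
    notE1 (inj₁ (h , _)) = 1+c+[a+b]≰a L x' 1 h
    notE1 (inj₂ (x'' , e , e1)) = notE1' (subst (E1 Ls) (sym (+-cancelˡ-≡ L _ _ e)) e1)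

  -- Good cuts are dense: of two positions p < p' < N at distance between 8 and
  -- 16, at least one is good (segments have length ≥ 30, so a segment boundary
  -- can spoil at most one of them).
  Good-dense : ∀ Ls → Long Ls → ∀ p p' → 8 + p ≤ p' → p' ≤ 16 + p → p' < sum Ls →
    Good Ls p ⊎ Good Ls p'
  Good-dense (L ∷ Ls) (30≤L ∷ long) p p' h8 h16 p'<N with L ≤? p
  ... | yes L≤p with ≤⇒shift L p L≤p | ≤⇒shift L p' (≤-trans L≤p (≤-trans (m≤n+m p 8) h8))
  ...   | x , refl | x' , refl = shifted (Good-dense Ls long x x' h8' h16' x'<N)
    where
    h8' : 8 + x ≤ x'
    h8' = +-cancelˡ-≤ L _ _ (≤-trans (≤-reflexive (sym (+-exchange 8 L x))) h8)
    h16' : x' ≤ 16 + x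
    h16' = +-cancelˡ-≤ L _ _ (≤-trans h16 (≤-reflexive (+-exchange 16 L x)))
    x'<N : x' < sum Ls
    x'<N = +-cancelˡ-≤ L _ _ (≤-trans (≤-reflexive (+-suc L x')) p'<N)
    shifted : Good Ls x ⊎ Good Ls x' → Good (L ∷ Ls) (L + x) ⊎ Good (L ∷ Ls) (L + x')
    shifted (inj₁ g) = inj₁ (inj₂ (x , refl , g))
    shifted (inj₂ g) = inj₂ (inj₂ (x' , refl , g))
  Good-dense (L ∷ Ls) (30≤L ∷ long) p p' h8 h16 p'<N | no L≰p with 4 ≤? p | 4 + p ≤? L
  ... | yes 4≤p | yes p+4≤L = inj₁ (inj₁ (4≤p , p+4≤L))
  ... | no 4≰p | _ = inj₂ (inj₁ (4≤p' , ≤-trans (+-monoʳ-≤ 4 p'≤19) (≤-trans (≤-lit 23 30) 30≤L)))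
    where
    4≤p' : 4 ≤ p'
    4≤p' = ≤-trans (m≤m+n 4 (4 + p)) h8
    p'≤19 : p' ≤ 19
    p'≤19 = ≤-trans h16 (+-monoʳ-≤ 16 (≤-pred (≰⇒> 4≰p)))
  ... | yes 4≤p | no p+4≰L with p' <? L
  ...   | yes p'<L = ⊥-elim (n≮n p' (≤-trans p'<L (≤-trans (≤-pred (≰⇒> p+4≰L))
                      (≤-trans (+-monoˡ-≤ p (≤-lit 3 8)) h8))))
  ...   | no p'≮L with ≤⇒shift L p' (≮⇒≥ p'≮L)
  ...     | x , refl with Ls | long
  ...       | [] | _ = ⊥-elim (1+c+[a+b]≰a L x 0 (≤-trans p'<N (≤-reflexive (+-identityʳ L))))
  ...       | L₂ ∷ _ | 30≤L₂ ∷ _ =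
    inj₂ (inj₂ (x , refl , inj₁ (4≤x , ≤-trans (+-monoʳ-≤ 4 x≤15) (≤-trans (≤-lit 19 30) 30≤L₂))))
    where
    L≤3+p : L ≤ 3 + p
    L≤3+p = ≤-pred (≰⇒> p+4≰L)
    4≤x : 4 ≤ x
    4≤x = ≤-trans (n≤1+n 4) (+-cancelˡ-≤ L _ _ (≤-trans (≤-reflexive (+-comm L 5))
            (≤-trans (+-monoʳ-≤ 5 L≤3+p) h8)))
    x≤15 : x ≤ 15
    x≤15 = ≤-pred (+-cancelˡ-< L x 16 (≤-trans (≤-<-trans h16 (+-monoʳ-< 16 (≰⇒> L≰p)))
             (≤-reflexive (+-comm 16 L))))

  Good? : ∀ Ls c → Dec (Good Ls c)
  Good? [] c = no (λ ())
  Good? (L ∷ Ls) c with L ≤? c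
  ... | no L≰c with 4 ≤? c | 4 + c ≤? L
  ...   | yes a | yes b = yes (inj₁ (a , b))
  ...   | no ¬a | _ = no λ { (inj₁ (a , b)) → ¬a a ; (inj₂ (c' , refl , _)) → L≰c (m≤m+n L c') }
  ...   | yes _ | no ¬b = no λ { (inj₁ (a , b)) → ¬b b ; (inj₂ (c' , refl , _)) → L≰c (m≤m+n L c') }
  Good? (L ∷ Ls) c | yes L≤c with ≤⇒shift L c L≤c
  ...     | c' , refl with Good? Ls c'
  ...       | yes g = yes (inj₂ (c' , refl , g))
  ...       | no ¬g = no λ { (inj₁ (a , b)) → 1+c+[a+b]≰a L c' 3 b
                           ; (inj₂ (c'' , e , g)) → ¬g (subst (Good Ls) (sym (+-cancelˡ-≡ L _ _ e)) g) }

  E2? : ∀ Ls p → Dec (E2 Ls p)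
  E2? [] p = no (λ ())
  E2? (L ∷ Ls) p with 3 + p ≤? L
  ... | yes h = yes (inj₁ h)
  ... | no ¬h with L ≤? p
  ...   | no L≰p = no λ { (inj₁ h) → ¬h h ; (inj₂ (p' , refl , _)) → L≰p (m≤m+n L p') }
  ...   | yes L≤p with ≤⇒shift L p L≤p
  ...     | p' , refl with E2? Ls p'
  ...       | yes g = yes (inj₂ (p' , refl , g))
  ...       | no ¬g = no λ { (inj₁ h) → ¬h h
                           ; (inj₂ (p'' , e , g)) → ¬g (subst (E2 Ls) (sym (+-cancelˡ-≡ L _ _ e)) g) }

  E1? : ∀ Ls p → Dec (E1 Ls p)
  E1? [] p = no (λ ())
  E1? (L ∷ Ls) p with 2 + p ≤? L | p ≟ℕ 0 | 2 + p ≟ℕ L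
  ... | yes h | yes e | _ = yes (inj₁ (h , inj₁ e))
  ... | yes h | no _ | yes e = yes (inj₁ (h , inj₂ e))
  ... | yes h | no p≢0 | no p+2≢L = no λ
    { (inj₁ (_ , inj₁ e)) → p≢0 e
    ; (inj₁ (_ , inj₂ e)) → p+2≢L e
    ; (inj₂ (p' , refl , _)) → 1+c+[a+b]≰a L p' 1 h }
  E1? (L ∷ Ls) p | no ¬h | _ | _ with L ≤? p
  ...   | no L≰p = no λ { (inj₁ (h , _)) → ¬h h ; (inj₂ (p' , refl , _)) → L≰p (m≤m+n L p') }
  ...   | yes L≤p with ≤⇒shift L p L≤p
  ...     | p' , refl with E1? Ls p'
  ...       | yes g = yes (inj₂ (p' , refl , g))
  ...       | no ¬g = no λ { (inj₁ (h , _)) → ¬h h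
                           ; (inj₂ (p'' , e , g)) → ¬g (subst (E1 Ls) (sym (+-cancelˡ-≡ L _ _ e)) g) }

  e2? e1? : List ℕ → ℕ → Bool
  e2? Ls s = ⌊ E2? Ls s ⌋
  e1? Ls s = ⌊ E1? Ls s ⌋

  MAdj-near : ∀ Ls x u → MAdj Ls x u → u ≤ 2 + x × x ≤ 2 + u
  MAdj-near Ls x u (inj₁ (_ , refl)) = ≤-refl , m≤n+m x 4
  MAdj-near Ls x u (inj₂ (inj₁ (_ , refl))) = m≤n+m u 4 , ≤-refl
  MAdj-near Ls x u (inj₂ (inj₂ (inj₁ (_ , refl)))) = n≤1+n _ , m≤n+m x 3
  MAdj-near Ls x u (inj₂ (inj₂ (inj₂ (_ , refl)))) = m≤n+m u 3 , n≤1+n _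

  MAdj-1 : ∀ Ls a → MAdj Ls a (suc a) → E1 Ls a
  MAdj-1 Ls a (inj₁ (_ , e)) = ⊥-elim (1+k+n≢n 0 (suc a) (sym e))
  MAdj-1 Ls a (inj₂ (inj₁ (_ , e))) = ⊥-elim (1+k+n≢n 2 a (sym e))
  MAdj-1 Ls a (inj₂ (inj₂ (inj₁ (x , _)))) = x
  MAdj-1 Ls a (inj₂ (inj₂ (inj₂ (_ , e)))) = ⊥-elim (1+k+n≢n 1 a (sym e))

  MAdj-1' : ∀ Ls a → MAdj Ls (suc a) a → E1 Ls a
  MAdj-1' Ls a (inj₁ (_ , e)) = ⊥-elim (1+k+n≢n 2 a (sym e))
  MAdj-1' Ls a (inj₂ (inj₁ (_ , e))) = ⊥-elim (1+k+n≢n 0 (suc a) (sym e))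
  MAdj-1' Ls a (inj₂ (inj₂ (inj₁ (_ , e)))) = ⊥-elim (1+k+n≢n 1 a (sym e))
  MAdj-1' Ls a (inj₂ (inj₂ (inj₂ (x , _)))) = x

  MAdj-3 : ∀ Ls a → ¬ MAdj Ls a (3 + a)
  MAdj-3 Ls a (inj₁ (_ , e)) = 1+k+n≢n 0 (2 + a) e
  MAdj-3 Ls a (inj₂ (inj₁ (_ , e))) = 1+k+n≢n 4 a (sym e)
  MAdj-3 Ls a (inj₂ (inj₂ (inj₁ (_ , e)))) = 1+k+n≢n 1 (suc a) e
  MAdj-3 Ls a (inj₂ (inj₂ (inj₂ (_ , e)))) = 1+k+n≢n 3 a (sym e)

  MAdj-3' : ∀ Ls a → ¬ MAdj Ls (3 + a) a
  MAdj-3' Ls a (inj₁ (_ , e)) = 1+k+n≢n 4 a (sym e)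
  MAdj-3' Ls a (inj₂ (inj₁ (_ , e))) = 1+k+n≢n 0 (2 + a) e
  MAdj-3' Ls a (inj₂ (inj₂ (inj₁ (_ , e)))) = 1+k+n≢n 3 a (sym e)
  MAdj-3' Ls a (inj₂ (inj₂ (inj₂ (_ , e)))) = 1+k+n≢n 1 (suc a) e

  SegEdge : ℕ → ℕ → ℕ → Set
  SegEdge K o o' = (3 + o ≤ K × o' ≡ 2 + o) ⊎ ((2 + o ≤ K × (o ≡ 0 ⊎ 2 + o ≡ K)) × o' ≡ suc o)

  MAdj-shift : ∀ L Ls p q → MAdj Ls p q → MAdj (L ∷ Ls) (L + p) (L + q)
  MAdj-shift L Ls p q (inj₁ (e , refl)) = inj₁ (inj₂ (p , refl , e) , sym (+-exchange 2 L p))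
  MAdj-shift L Ls p q (inj₂ (inj₁ (e , refl))) = inj₂ (inj₁ (inj₂ (q , refl , e) , sym (+-exchange 2 L q)))
  MAdj-shift L Ls p q (inj₂ (inj₂ (inj₁ (e , refl)))) = inj₂ (inj₂ (inj₁ (inj₂ (p , refl , e) , +-suc L p)))
  MAdj-shift L Ls p q (inj₂ (inj₂ (inj₂ (e , refl)))) = inj₂ (inj₂ (inj₂ (inj₂ (q , refl , e) , +-suc L q)))

  MAdj-split : ∀ L Ls p p' → MAdj (L ∷ Ls) p p' →
    (p < L × p' < L × (SegEdge L p p' ⊎ SegEdge L p' p))
    ⊎ Σ ℕ (λ x → Σ ℕ λ x' → p ≡ L + x × p' ≡ L + x' × MAdj Ls x x')
  MAdj-split L Ls p .(2 + p) (inj₁ (inj₁ h , refl)) =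
    inj₁ (≤-trans (n≤1+n _) (≤-trans (n≤1+n _) h) , h , inj₁ (inj₁ (h , refl)))
  MAdj-split L Ls .(L + x) .(2 + (L + x)) (inj₁ (inj₂ (x , refl , e) , refl)) =
    inj₂ (x , 2 + x , refl , +-exchange 2 L x , inj₁ (e , refl))
  MAdj-split L Ls .(2 + p') p' (inj₂ (inj₁ (inj₁ h , refl))) =
    inj₁ (h , ≤-trans (n≤1+n _) (≤-trans (n≤1+n _) h) , inj₂ (inj₁ (h , refl)))
  MAdj-split L Ls .(2 + (L + x)) .(L + x) (inj₂ (inj₁ (inj₂ (x , refl , e) , refl))) =
    inj₂ (2 + x , x , +-exchange 2 L x , refl , inj₂ (inj₁ (e , refl)))
  MAdj-split L Ls p .(suc p) (inj₂ (inj₂ (inj₁ (inj₁ (h , w) , refl)))) =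
    inj₁ (≤-trans (n≤1+n _) h , h , inj₁ (inj₂ ((h , w) , refl)))
  MAdj-split L Ls .(L + x) .(suc (L + x)) (inj₂ (inj₂ (inj₁ (inj₂ (x , refl , e) , refl)))) =
    inj₂ (x , suc x , refl , sym (+-suc L x) , inj₂ (inj₂ (inj₁ (e , refl))))
  MAdj-split L Ls .(suc p') p' (inj₂ (inj₂ (inj₂ (inj₁ (h , w) , refl)))) =
    inj₁ (h , ≤-trans (n≤1+n _) h , inj₂ (inj₂ ((h , w) , refl)))
  MAdj-split L Ls .(suc (L + x)) .(L + x) (inj₂ (inj₂ (inj₂ (inj₂ (x , refl , e) , refl)))) =
    inj₂ (suc x , x , sym (+-suc L x) , refl , inj₂ (inj₂ (inj₂ (e , refl))))

  TwoNeighbours : List ℕ → ℕ → Set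
  TwoNeighbours Ls p = Σ ℕ λ q₁ → Σ ℕ λ q₂ →
    q₁ ≢ q₂ × q₁ < sum Ls × q₂ < sum Ls × MAdj Ls p q₁ × MAdj Ls p q₂

  twoNeighbours : ∀ Ls → Long Ls → ∀ p → p < sum Ls → TwoNeighbours Ls p
  twoNeighbours (L ∷ Ls) (30≤L ∷ long) p p<N with p <? L
  ... | no p≮L with ≤⇒shift L p (≮⇒≥ p≮L)
  ...   | p' , refl with twoNeighbours Ls long p' (+-cancelˡ-< L p' (sum Ls) p<N)
  ...     | q₁ , q₂ , q₁≢q₂ , h₁ , h₂ , a₁ , a₂ =
    L + q₁ , L + q₂ , (λ e → q₁≢q₂ (+-cancelˡ-≡ L q₁ q₂ e)) , +-monoʳ-< L h₁ , +-monoʳ-< L h₂ ,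
    MAdj-shift L Ls p' q₁ a₁ , MAdj-shift L Ls p' q₂ a₂
  twoNeighbours (L ∷ Ls) (30≤L ∷ long) p p<N | yes p<L = inFirst p p<L
    where
    inL : ∀ x → x < L → x < L + sum Ls
    inL x x<L = ≤-trans x<L (m≤m+n L (sum Ls))
    lit<L : ∀ x → {w : True (suc x ≤? 30)} → x < L
    lit<L x {w} = ≤-trans (toWitness w) 30≤L
    inFirst : ∀ p → p < L → TwoNeighbours (L ∷ Ls) p
    inFirst zero _ =
      1 , 2 , (λ ()) , inL 1 (lit<L 1) , inL 2 (lit<L 2) ,
      inj₂ (inj₂ (inj₁ (inj₁ (lit<L 1 , inj₁ refl) , refl))) , inj₁ (inj₁ (lit<L 2) , refl)
    inFirst (suc zero) _ =
      0 , 3 , (λ ()) , inL 0 (lit<L 0) , inL 3 (lit<L 3) ,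
      inj₂ (inj₂ (inj₂ (inj₁ (lit<L 1 , inj₁ refl) , refl))) , inj₁ (inj₁ (lit<L 3) , refl)
    inFirst (suc (suc o)) o+2<L with 5 + o ≤? L
    ... | yes o+5≤L =
      o , 4 + o , (λ e → 1+k+n≢n 3 o (sym e)) , inL o (≤-trans (m≤n+m _ 2) o+2<L) , inL (4 + o) o+5≤L ,
      inj₂ (inj₁ (inj₁ (≤-trans (m≤n+m _ 2) o+5≤L) , refl)) , inj₁ (inj₁ o+5≤L , refl)
    ... | no o+5≰L with m≤n⇒m<n∨m≡n o+2<L
    ...   | inj₂ refl =
      o , suc o , (λ e → 1+k+n≢n 0 o (sym e)) , inL o (≤-trans (m≤n+m _ 2) o+2<L) ,
      inL (suc o) (≤-trans (m≤n+m _ 1) o+2<L) ,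
      inj₂ (inj₁ (inj₁ ≤-refl , refl)) , inj₂ (inj₂ (inj₂ (inj₁ (≤-refl , inj₂ refl) , refl)))
    ...   | inj₁ o+4≤L with ≤-antisym (≤-pred (≰⇒> o+5≰L)) o+4≤L
    ...     | refl =
      o , 3 + o , (λ e → 1+k+n≢n 2 o (sym e)) , inL o (≤-trans (m≤n+m _ 2) o+2<L) , inL (3 + o) ≤-refl ,
      inj₂ (inj₁ (inj₁ (n≤1+n _) , refl)) , inj₂ (inj₂ (inj₁ (inj₁ (≤-refl , inj₂ refl) , refl)))

open Model

-- The model adjacency is given as a
-- Boolean relation b on the positions below N; a sum of weights over all
-- ordered pairs (p, p') with b p p' splits into sums over the four kinds of
-- edges (p, p+2), (p+2, p), (p, p+1), (p+1, p).
module EdgeSum (Ls : List ℕ) (b : ℕ → ℕ → Bool)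
               (b⇒MAdj : ∀ p p' → p < sum Ls → p' < sum Ls → b p p' ≡ true → MAdj Ls p p')
               (MAdj⇒b : ∀ p p' → p < sum Ls → p' < sum Ls → MAdj Ls p p' → b p p' ≡ true) where

  N : ℕ
  N = sum Ls

  fwd2 bwd2 fwd1 bwd1 : ℕ → ℕ → Bool
  fwd2 p p' = e2? Ls p ∧ eqℕ p' (2 + p)
  bwd2 p p' = e2? Ls p' ∧ eqℕ p (2 + p')
  fwd1 p p' = e1? Ls p ∧ eqℕ p' (1 + p)
  bwd1 p p' = e1? Ls p' ∧ eqℕ p (1 + p')

  ∧-true : ∀ {x y} → x ∧ y ≡ true → x ≡ true × y ≡ true
  ∧-true {true} {true} _ = refl , refl

  ∨-true : ∀ {x y} → x ∨ y ≡ true → x ≡ true ⊎ y ≡ true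
  ∨-true {true} _ = inj₁ refl
  ∨-true {false} e = inj₂ e

  true-∧ : ∀ {P : Set} (d : Dec P) {y} → P → y ≡ true → ⌊ d ⌋ ∧ y ≡ true
  true-∧ d p refl rewrite dec-true d p = refl

  ∨-trueˡ : ∀ {x} y → x ≡ true → x ∨ y ≡ true
  ∨-trueˡ y refl = refl

  ∨-trueʳ : ∀ x {y} → y ≡ true → x ∨ y ≡ true
  ∨-trueʳ true _ = refl
  ∨-trueʳ false e = e

  MAdj⇒kind : ∀ p p' → MAdj Ls p p' → (fwd2 p p' ∨ bwd2 p p' ∨ fwd1 p p' ∨ bwd1 p p') ≡ true
  MAdj⇒kind p p' (inj₁ (x , e)) = ∨-trueˡ _ (true-∧ (E2? Ls p) x (eqℕ-true e))
  MAdj⇒kind p p' (inj₂ (inj₁ (x , e))) = ∨-trueʳ (fwd2 p p') (∨-trueˡ _ (true-∧ (E2? Ls p') x (eqℕ-true e)))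
  MAdj⇒kind p p' (inj₂ (inj₂ (inj₁ (x , e)))) =
    ∨-trueʳ (fwd2 p p') (∨-trueʳ (bwd2 p p') (∨-trueˡ _ (true-∧ (E1? Ls p) x (eqℕ-true e))))
  MAdj⇒kind p p' (inj₂ (inj₂ (inj₂ (x , e)))) =
    ∨-trueʳ (fwd2 p p') (∨-trueʳ (bwd2 p p') (∨-trueʳ (fwd1 p p') (true-∧ (E1? Ls p') x (eqℕ-true e))))

  kind⇒MAdj : ∀ p p' → (fwd2 p p' ∨ bwd2 p p' ∨ fwd1 p p' ∨ bwd1 p p') ≡ true → MAdj Ls p p'
  kind⇒MAdj p p' k with ∨-true {fwd2 p p'} k
  ... | inj₁ e = let a , c = ∧-true e in inj₁ (dec-sound (E2? Ls p) a , eqℕ-sound c)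
  ... | inj₂ k' with ∨-true {bwd2 p p'} k'
  ...   | inj₁ e = let a , c = ∧-true e in inj₂ (inj₁ (dec-sound (E2? Ls p') a , eqℕ-sound c))
  ...   | inj₂ k'' with ∨-true {fwd1 p p'} k''
  ...     | inj₁ e = let a , c = ∧-true e in inj₂ (inj₂ (inj₁ (dec-sound (E1? Ls p) a , eqℕ-sound c)))
  ...     | inj₂ e = let a , c = ∧-true e in inj₂ (inj₂ (inj₂ (dec-sound (E1? Ls p') a , eqℕ-sound c)))

  differences-exclusive : ∀ p p' →
    ind (eqℕ p' (2 + p)) + (ind (eqℕ p (2 + p')) + (ind (eqℕ p' (1 + p)) + ind (eqℕ p (1 + p')))) ≤ 1
  differences-exclusive p p' with p' ≟ℕ 2 + p
  ... | yes refl rewrite eqℕ-false {p} {2 + (2 + p)} (λ e → 1+k+n≢n 3 p (sym e))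
                       | eqℕ-false {2 + p} {1 + p} (1+k+n≢n 0 (suc p))
                       | eqℕ-false {p} {1 + (2 + p)} (λ e → 1+k+n≢n 2 p (sym e)) = ≤-refl
  ... | no _ with p ≟ℕ 2 + p'
  ...   | yes refl rewrite eqℕ-false {p'} {1 + (2 + p')} (λ e → 1+k+n≢n 2 p' (sym e))
                         | eqℕ-false {2 + p'} {1 + p'} (1+k+n≢n 0 (suc p')) = ≤-refl
  ...   | no _ with p' ≟ℕ 1 + p
  ...     | yes refl rewrite eqℕ-false {p} {1 + (1 + p)} (λ e → 1+k+n≢n 1 p (sym e)) = ≤-refl
  ...     | no _ = ind≤1 (eqℕ p (1 + p'))

  ind-∧≤ : ∀ x y → ind (x ∧ y) ≤ ind y
  ind-∧≤ true y = ≤-refl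
  ind-∧≤ false y = z≤n

  kinds-exclusive : ∀ p p' → ind (fwd2 p p') + (ind (bwd2 p p') + (ind (fwd1 p p') + ind (bwd1 p p'))) ≤ 1
  kinds-exclusive p p' = ≤-trans
    (+-mono-≤ (ind-∧≤ (e2? Ls p) _) (+-mono-≤ (ind-∧≤ (e2? Ls p') _) (+-mono-≤ (ind-∧≤ (e1? Ls p) _) (ind-∧≤ (e1? Ls p') _))))
    (differences-exclusive p p')

  ind-edge : ∀ p p' → p < N → p' < N →
    ind (b p p') ≡ ind (fwd2 p p') + (ind (bwd2 p p') + (ind (fwd1 p p') + ind (bwd1 p p')))
  ind-edge p p' p<N p'<N = begin
    ind (b p p')
      ≡⟨ cong ind (bool-ext (λ e → MAdj⇒kind p p' (b⇒MAdj p p' p<N p'<N e)) (λ e → MAdj⇒b p p' p<N p'<N (kind⇒MAdj p p' e))) ⟩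
    ind (f₂ ∨ b₂ ∨ f₁ ∨ b₁)
      ≡⟨ ind-∨ f₂ (b₂ ∨ f₁ ∨ b₁) (subst (λ z → ind f₂ + z ≤ 1) (sym rest) excl) ⟩
    ind f₂ + ind (b₂ ∨ f₁ ∨ b₁)
      ≡⟨ cong (ind f₂ +_) rest ⟩
    ind f₂ + (ind b₂ + (ind f₁ + ind b₁)) ∎
    where
    open ≡-Reasoning
    f₂ = fwd2 p p'
    b₂ = bwd2 p p'
    f₁ = fwd1 p p'
    b₁ = bwd1 p p'
    excl = kinds-exclusive p p'
    last2 : ind (f₁ ∨ b₁) ≡ ind f₁ + ind b₁
    last2 = ind-∨ f₁ b₁ (m+n≤o⇒n≤o (ind b₂) (m+n≤o⇒n≤o (ind f₂) excl))
    rest : ind (b₂ ∨ f₁ ∨ b₁) ≡ ind b₂ + (ind f₁ + ind b₁)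
    rest = trans (ind-∨ b₂ (f₁ ∨ b₁) (subst (λ z → ind b₂ + z ≤ 1) (sym last2) (m+n≤o⇒n≤o (ind f₂) excl)))
                 (cong (ind b₂ +_) last2)

  sumBelow-+₄ : ∀ n (f g h k : ℕ → ℕ) →
    sumBelow n (λ i → f i + (g i + (h i + k i))) ≡ sumBelow n f + (sumBelow n g + (sumBelow n h + sumBelow n k))
  sumBelow-+₄ n f g h k =
    trans (sumBelow-+ n f _) (cong (sumBelow n f +_) (trans (sumBelow-+ n g _) (cong (sumBelow n g +_) (sumBelow-+ n h k))))

  *-distribʳ-+₄ : ∀ a b c d g → (a + (b + (c + d))) * g ≡ a * g + (b * g + (c * g + d * g))
  *-distribʳ-+₄ a b c d g =
    trans (*-distribʳ-+ g a _) (cong (a * g +_) (trans (*-distribʳ-+ g b _) (cong (b * g +_) (*-distribʳ-+ g c d))))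

  forward-sum : ∀ k (A : ℕ → Bool) → (∀ s → A s ≡ true → k + s < N) → ∀ (g : ℕ → ℕ → ℕ) →
    sumBelow N (λ p → sumBelow N (λ p' → ind (A p ∧ eqℕ p' (k + p)) * g p p')) ≡ sumBelow N (λ s → ind (A s) * g s (k + s))
  forward-sum k A bound g = sumBelow-cong N (λ p _ → sumBelow-delta-if N (A p) (k + p) (g p) (bound p))

  backward-sum : ∀ k (A : ℕ → Bool) → (∀ s → A s ≡ true → k + s < N) → ∀ (g : ℕ → ℕ → ℕ) →
    sumBelow N (λ p → sumBelow N (λ p' → ind (A p' ∧ eqℕ p (k + p')) * g p p')) ≡ sumBelow N (λ s → ind (A s) * g (k + s) s)
  backward-sum k A bound g =
    trans (sumBelow-swap N N _) (sumBelow-cong N (λ p' _ → sumBelow-delta-if N (A p') (k + p') (λ p → g p p') (bound p')))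

  e2-bound : ∀ s → e2? Ls s ≡ true → 2 + s < N
  e2-bound s e = E2-bound Ls s (dec-sound (E2? Ls s) e)

  e1-bound : ∀ s → e1? Ls s ≡ true → 1 + s < N
  e1-bound s e = E1-bound Ls s (dec-sound (E1? Ls s) e)

  sum-over-edges : ∀ (g : ℕ → ℕ → ℕ) →
    sumBelow N (λ p → sumBelow N (λ p' → ind (b p p') * g p p')) ≡
      sumBelow N (λ s → ind (e2? Ls s) * g s (2 + s)) + (sumBelow N (λ s → ind (e2? Ls s) * g (2 + s) s)
      + (sumBelow N (λ s → ind (e1? Ls s) * g s (1 + s)) + sumBelow N (λ s → ind (e1? Ls s) * g (1 + s) s)))
  sum-over-edges g = begin
    sumBelow N (λ p → sumBelow N (λ p' → ind (b p p') * g p p'))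
      ≡⟨ sumBelow-cong N (λ p p<N → trans (sumBelow-cong N (λ p' p'<N →
           trans (cong (_* g p p') (ind-edge p p' p<N p'<N))
             (*-distribʳ-+₄ (ind (fwd2 p p')) (ind (bwd2 p p')) (ind (fwd1 p p')) (ind (bwd1 p p')) (g p p'))))
           (sumBelow-+₄ N _ _ _ _)) ⟩
    sumBelow N (λ p → S fwd2 p + (S bwd2 p + (S fwd1 p + S bwd1 p)))
      ≡⟨ sumBelow-+₄ N _ _ _ _ ⟩
    sumBelow N (S fwd2) + (sumBelow N (S bwd2) + (sumBelow N (S fwd1) + sumBelow N (S bwd1)))
      ≡⟨ cong₂ _+_ (forward-sum 2 (e2? Ls) e2-bound g) (cong₂ _+_ (backward-sum 2 (e2? Ls) e2-bound g)
           (cong₂ _+_ (forward-sum 1 (e1? Ls) e1-bound g) (backward-sum 1 (e1? Ls) e1-bound g))) ⟩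
    _ ∎
    where
    open ≡-Reasoning
    S : (ℕ → ℕ → Bool) → ℕ → ℕ
    S kind p = sumBelow N (λ p' → ind (kind p p') * g p p')

-- A list of windows
-- (a₁,b₁),(a₂,b₂),… with [a₁,b₁) ⊃ [a₂,b₂) ⊃ … labels a position by the number of
-- windows containing it (counting only an unbroken initial run).
module Windows where

  Windows : Set
  Windows = List (ℕ × ℕ)

  label : Windows → ℕ → ℕ
  label [] p = 0
  label ((a , b) ∷ ws) p with a ≤? p | p <? b
  ... | yes _ | yes _ = suc (label ws p)
  ... | _ | _ = 0

  label-inside : ∀ a b ws p → a ≤ p → p < b → label ((a , b) ∷ ws) p ≡ suc (label ws p)
  label-inside a b ws p a≤p p<b with a ≤? p | p <? b
  ... | yes _ | yes _ = refl
  ... | no a≰p | _ = ⊥-elim (a≰p a≤p)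
  ... | yes _ | no p≮b = ⊥-elim (p≮b p<b)

  label-before : ∀ a b ws p → p < a → label ((a , b) ∷ ws) p ≡ 0
  label-before a b ws p p<a with a ≤? p | p <? b
  ... | yes a≤p | yes _ = ⊥-elim (n≮n p (≤-trans p<a a≤p))
  ... | yes _ | no _ = refl
  ... | no _ | _ = refl

  label-after : ∀ a b ws p → b ≤ p → label ((a , b) ∷ ws) p ≡ 0
  label-after a b ws p b≤p with a ≤? p | p <? b
  ... | yes _ | yes p<b = ⊥-elim (n≮n p (≤-trans p<b b≤p))
  ... | yes _ | no _ = refl
  ... | no _ | _ = refl

  label≤length : ∀ ws p → label ws p ≤ length ws
  label≤length [] p = z≤n
  label≤length ((a , b) ∷ ws) p with a ≤? p | p <? b
  ... | yes _ | yes _ = s≤s (label≤length ws p)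
  ... | yes _ | no _ = z≤n
  ... | no _ | _ = z≤n

  Nested : List ℕ → ℕ → ℕ → Windows → Set
  Nested Ls x y [] = ⊤
  Nested Ls x y ((a , b) ∷ ws) =
    8 + x ≤ a × 50 + a ≤ b × 8 + b ≤ y × Good Ls a × Good Ls b × Nested Ls a b ws

  label-below : ∀ Ls x y ws → Nested Ls x y ws → ∀ p → p < 8 + x → label ws p ≡ 0
  label-below Ls x y [] _ p _ = refl
  label-below Ls x y ((a , b) ∷ ws) (x+8≤a , _) p p<x+8 = label-before a b ws p (≤-trans p<x+8 x+8≤a)

  label-above : ∀ Ls x y ws → Nested Ls x y ws → ∀ p → y ≤ 8 + p → label ws p ≡ 0
  label-above Ls x y [] _ p _ = refl
  label-above Ls x y ((a , b) ∷ ws) (_ , _ , b+8≤y , _) p y≤p+8 =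
    label-after a b ws p (+-cancelˡ-≤ 8 _ _ (≤-trans b+8≤y y≤p+8))

  leftCut : Windows → ℕ → ℕ
  leftCut [] q = 0
  leftCut ((a , b) ∷ ws) zero = a
  leftCut (_ ∷ ws) (suc q) = leftCut ws q

  rightCut : Windows → ℕ → ℕ
  rightCut [] q = 0
  rightCut ((a , b) ∷ ws) zero = b
  rightCut (_ ∷ ws) (suc q) = rightCut ws q

  cut-range : ∀ Ls x y ws → Nested Ls x y ws → ∀ q → q < length ws →
    8 + x ≤ leftCut ws q × 50 + leftCut ws q ≤ rightCut ws q × 8 + rightCut ws q ≤ y
  cut-range Ls x y ((a , b) ∷ ws) (h₁ , h₂ , h₃ , _) zero _ = h₁ , h₂ , h₃
  cut-range Ls x y ((a , b) ∷ ws) (h₁ , h₂ , h₃ , _ , _ , nest) (suc q) (s≤s q<len)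
    with cut-range Ls a b ws nest q q<len
  ... | d₁ , d₂ , d₃ = ≤-trans (+-monoʳ-≤ 8 (≤-trans (m≤n+m x 8) h₁)) d₁ , d₂ ,
                       ≤-trans d₃ (≤-trans (m≤n+m b 8) h₃)

  cuts-good : ∀ Ls x y ws → Nested Ls x y ws → ∀ q → q < length ws →
    Good Ls (leftCut ws q) × Good Ls (rightCut ws q)
  cuts-good Ls x y ((a , b) ∷ ws) (_ , _ , _ , ga , gb , _) zero _ = ga , gb
  cuts-good Ls x y ((a , b) ∷ ws) (_ , _ , _ , _ , _ , nest) (suc q) (s≤s q<len) =
    cuts-good Ls a b ws nest q q<len

  enter : ∀ Ls x y a b ws → Nested Ls x y ((a , b) ∷ ws) → ∀ u v → u < a → a ≤ v → v ≤ 2 + u →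
    label ((a , b) ∷ ws) u ≡ 0 × label ((a , b) ∷ ws) v ≡ 1
  enter Ls x y a b ws (_ , a+50≤b , _ , _ , _ , nest) u v u<a a≤v v≤u+2 =
    label-before a b ws u u<a ,
    trans (label-inside a b ws v a≤v v<b) (cong suc (label-below Ls a b ws nest v v<a+8))
    where
    v<a+2 : v < 2 + a
    v<a+2 = ≤-trans (s≤s v≤u+2) (+-monoʳ-≤ 2 u<a)
    v<b : v < b
    v<b = ≤-trans v<a+2 (≤-trans (+-monoˡ-≤ a (≤-lit 2 50)) a+50≤b)
    v<a+8 : v < 8 + a
    v<a+8 = ≤-trans v<a+2 (+-monoˡ-≤ a (≤-lit 2 8))

  leave : ∀ Ls x y a b ws → Nested Ls x y ((a , b) ∷ ws) → ∀ u v → u < b → b ≤ v → v ≤ 2 + u →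
    label ((a , b) ∷ ws) u ≡ 1 × label ((a , b) ∷ ws) v ≡ 0
  leave Ls x y a b ws (_ , a+50≤b , _ , _ , _ , nest) u v u<b b≤v v≤u+2 =
    trans (label-inside a b ws u a≤u u<b) (cong suc (label-above Ls a b ws nest u b≤u+8)) ,
    label-after a b ws v b≤v
    where
    b≤u+8 : b ≤ 8 + u
    b≤u+8 = ≤-trans b≤v (≤-trans v≤u+2 (+-monoˡ-≤ u (≤-lit 2 8)))
    a≤u : a ≤ u
    a≤u = ≤-trans (m≤n+m a 48) (+-cancelˡ-≤ 2 _ _ (≤-trans a+50≤b (≤-trans b≤v v≤u+2)))

  data Step (ws : Windows) (u v : ℕ) : Set where
    flat : label ws u ≡ label ws v → Step ws u v
    up   : ∀ q → q < length ws → label ws u ≡ q → label ws v ≡ suc q →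
           u < leftCut ws q → leftCut ws q ≤ v → Step ws u v
    down : ∀ q → q < length ws → label ws u ≡ suc q → label ws v ≡ q →
           u < rightCut ws q → rightCut ws q ≤ v → Step ws u v

  step : ∀ Ls x y ws → Nested Ls x y ws → ∀ u v → u < v → v ≤ 2 + u → Step ws u v
  step Ls x y [] _ u v _ _ = flat refl
  step Ls x y ((a , b) ∷ ws) nest@(_ , _ , _ , _ , _ , nest') u v u<v v≤u+2 with v <? a | b ≤? u
  ... | yes v<a | _ = flat (trans (label-before a b ws u (<-trans u<v v<a)) (sym (label-before a b ws v v<a)))
  ... | no _ | yes b≤u =
    flat (trans (label-after a b ws u b≤u) (sym (label-after a b ws v (≤-trans b≤u (<⇒≤ u<v)))))
  ... | no v≮a | no b≰u with u <? a
  ...   | yes u<a = let e₁ , e₂ = enter Ls x y a b ws nest u v u<a (≮⇒≥ v≮a) v≤u+2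
                    in up 0 (s≤s z≤n) e₁ e₂ u<a (≮⇒≥ v≮a)
  ...   | no u≮a with v <? b
  ...     | no v≮b = let e₁ , e₂ = leave Ls x y a b ws nest u v (≰⇒> b≰u) (≮⇒≥ v≮b) v≤u+2
                     in down 0 (s≤s z≤n) e₁ e₂ (≰⇒> b≰u) (≮⇒≥ v≮b)
  ...     | yes v<b with step Ls a b ws nest' u v u<v v≤u+2
  ...       | flat e = flat (trans inU (trans (cong suc e) (sym inV)))
    where
    inU = label-inside a b ws u (≮⇒≥ u≮a) (≰⇒> b≰u)
    inV = label-inside a b ws v (≮⇒≥ v≮a) v<b
  ...       | up q q<len e₁ e₂ l₁ l₂ =
    up (suc q) (s≤s q<len) (trans (label-inside a b ws u (≮⇒≥ u≮a) (≰⇒> b≰u)) (cong suc e₁))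
       (trans (label-inside a b ws v (≮⇒≥ v≮a) v<b) (cong suc e₂)) l₁ l₂
  ...       | down q q<len e₁ e₂ l₁ l₂ =
    down (suc q) (s≤s q<len) (trans (label-inside a b ws u (≮⇒≥ u≮a) (≰⇒> b≰u)) (cong suc e₁))
         (trans (label-inside a b ws v (≮⇒≥ v≮a) v<b) (cong suc e₂)) l₁ l₂

  leftCut-crossing : ∀ Ls x y ws → Nested Ls x y ws → ∀ q → q < length ws → ∀ u v →
    u < leftCut ws q → leftCut ws q ≤ v → v ≤ 2 + u → label ws u ≡ q × label ws v ≡ suc q
  leftCut-crossing Ls x y ((a , b) ∷ ws) nest zero _ u v = enter Ls x y a b ws nest u v
  leftCut-crossing Ls x y ((a , b) ∷ ws) (_ , _ , _ , _ , _ , nest') (suc q) (s≤s q<len) u v u<c c≤v v≤u+2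
    with cut-range Ls a b ws nest' q q<len | leftCut-crossing Ls a b ws nest' q q<len u v u<c c≤v v≤u+2
  ... | a+8≤c , c+50≤c' , c'+8≤b | e₁ , e₂ =
    trans (label-inside a b ws u a≤u u<b) (cong suc e₁) , trans (label-inside a b ws v a≤v v<b) (cong suc e₂)
    where
    c = leftCut ws q
    a≤u : a ≤ u
    a≤u = ≤-trans (m≤n+m a 6) (+-cancelˡ-≤ 2 _ _ (≤-trans a+8≤c (≤-trans c≤v v≤u+2)))
    a≤v : a ≤ v
    a≤v = ≤-trans a≤u (≤-trans (n≤1+n u) (≤-trans u<c c≤v))
    c<b : ∀ k → {w : True (suc k ≤? 50)} → k + c < b
    c<b k {w} = ≤-trans (+-monoˡ-≤ c (toWitness w)) (≤-trans c+50≤c' (≤-trans (m≤n+m _ 8) c'+8≤b))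
    v<b : v < b
    v<b = ≤-<-trans (≤-trans v≤u+2 (+-monoʳ-≤ 2 (<⇒≤ u<c))) (c<b 2)
    u<b : u < b
    u<b = <-trans u<c (c<b 0)

  rightCut-crossing : ∀ Ls x y ws → Nested Ls x y ws → ∀ q → q < length ws → ∀ u v →
    u < rightCut ws q → rightCut ws q ≤ v → v ≤ 2 + u → label ws u ≡ suc q × label ws v ≡ q
  rightCut-crossing Ls x y ((a , b) ∷ ws) nest zero _ u v = leave Ls x y a b ws nest u v
  rightCut-crossing Ls x y ((a , b) ∷ ws) (_ , _ , _ , _ , _ , nest') (suc q) (s≤s q<len) u v u<c c≤v v≤u+2
    with cut-range Ls a b ws nest' q q<len | rightCut-crossing Ls a b ws nest' q q<len u v u<c c≤v v≤u+2
  ... | a+8≤c' , c'+50≤c , c+8≤b | e₁ , e₂ =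
    trans (label-inside a b ws u a≤u u<b) (cong suc e₁) , trans (label-inside a b ws v a≤v v<b) (cong suc e₂)
    where
    c = rightCut ws q
    a≤u : a ≤ u
    a≤u = ≤-trans (m≤n+m a 56) (+-cancelˡ-≤ 2 _ _ (≤-trans (+-monoʳ-≤ 50 a+8≤c')
            (≤-trans c'+50≤c (≤-trans c≤v v≤u+2))))
    a≤v : a ≤ v
    a≤v = ≤-trans a≤u (≤-trans (n≤1+n u) (≤-trans u<c c≤v))
    v<b : v < b
    v<b = ≤-trans (s≤s (≤-trans v≤u+2 (+-monoʳ-≤ 2 (<⇒≤ u<c)))) (≤-trans (+-monoˡ-≤ c (≤-lit 3 8)) c+8≤b)
    u<b : u < b
    u<b = <-≤-trans u<c (≤-trans (m≤n+m c 8) c+8≤b)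

  IsCut : Windows → ℕ → Set
  IsCut ws c = Σ ℕ (λ q → q < length ws × (leftCut ws q ≡ c ⊎ rightCut ws q ≡ c))

  IsCut-range : ∀ Ls x y ws → Nested Ls x y ws → ∀ c → IsCut ws c → 8 + x ≤ c × 8 + c ≤ y
  IsCut-range Ls x y ws nest c (q , q<len , inj₁ refl) with cut-range Ls x y ws nest q q<len
  ... | d₁ , d₂ , d₃ = d₁ , ≤-trans (+-monoʳ-≤ 8 (≤-trans (m≤n+m _ 50) d₂)) d₃
  IsCut-range Ls x y ws nest c (q , q<len , inj₂ refl) with cut-range Ls x y ws nest q q<len
  ... | d₁ , d₂ , d₃ = ≤-trans d₁ (≤-trans (m≤n+m _ 50) d₂) , d₃

  IsCut-good : ∀ Ls x y ws → Nested Ls x y ws → ∀ c → IsCut ws c → Good Ls c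
  IsCut-good Ls x y ws nest c (q , q<len , inj₁ refl) = proj₁ (cuts-good Ls x y ws nest q q<len)
  IsCut-good Ls x y ws nest c (q , q<len , inj₂ refl) = proj₂ (cuts-good Ls x y ws nest q q<len)

  cuts-apart : ∀ Ls x y ws → Nested Ls x y ws → ∀ c c' → IsCut ws c → IsCut ws c' → c < c' → 8 + c ≤ c'
  cuts-apart Ls x y ((a , b) ∷ ws) nest c c' (zero , _ , inj₁ refl) (zero , _ , inj₁ refl) c<c' =
    ⊥-elim (n≮n c c<c')
  cuts-apart Ls x y ((a , b) ∷ ws) (_ , a+50≤b , _) c c' (zero , _ , inj₁ refl) (zero , _ , inj₂ refl) _ =
    ≤-trans (+-monoˡ-≤ a (≤-lit 8 50)) a+50≤b
  cuts-apart Ls x y ((a , b) ∷ ws) (_ , a+50≤b , _) c c' (zero , _ , inj₂ refl) (zero , _ , inj₁ refl) b<a =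
    ⊥-elim (n≮n b (<-trans b<a (≤-trans (m≤n+m _ 49) a+50≤b)))
  cuts-apart Ls x y ((a , b) ∷ ws) nest c c' (zero , _ , inj₂ refl) (zero , _ , inj₂ refl) c<c' =
    ⊥-elim (n≮n c c<c')
  cuts-apart Ls x y ((a , b) ∷ ws) (_ , _ , _ , _ , _ , nest') c c' (zero , _ , inj₁ refl) (suc q' , s≤s q'<len , d') _ =
    proj₁ (IsCut-range Ls a b ws nest' c' (q' , q'<len , d'))
  cuts-apart Ls x y ((a , b) ∷ ws) (_ , _ , _ , _ , _ , nest') c c' (zero , _ , inj₂ refl) (suc q' , s≤s q'<len , d') b<c' =
    ⊥-elim (n≮n b (<-trans b<c' (≤-trans (m≤n+m _ 7) (proj₂ (IsCut-range Ls a b ws nest' c' (q' , q'<len , d'))))))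
  cuts-apart Ls x y ((a , b) ∷ ws) (_ , _ , _ , _ , _ , nest') c c' (suc q , s≤s q<len , d) (zero , _ , inj₁ refl) c<a =
    ⊥-elim (n≮n c (<-trans c<a (≤-trans (m≤n+m _ 7) (proj₁ (IsCut-range Ls a b ws nest' c (q , q<len , d))))))
  cuts-apart Ls x y ((a , b) ∷ ws) (_ , _ , _ , _ , _ , nest') c c' (suc q , s≤s q<len , d) (zero , _ , inj₂ refl) _ =
    proj₂ (IsCut-range Ls a b ws nest' c (q , q<len , d))
  cuts-apart Ls x y ((a , b) ∷ ws) (_ , _ , _ , _ , _ , nest') c c' (suc q , s≤s q<len , d) (suc q' , s≤s q'<len , d') c<c' =
    cuts-apart Ls a b ws nest' c c' (q , q<len , d) (q' , q'<len , d') c<c'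

open Windows

module Profile (last : ℕ) where

  span : List ℕ → ℕ
  span [] = last
  span (m ∷ ms) = m + span ms

  span≥last : ∀ ms → last ≤ span ms
  span≥last [] = ≤-refl
  span≥last (m ∷ ms) = ≤-trans (span≥last ms) (m≤n+m (span ms) m)

  size : List ℕ → ℕ → ℕ
  size [] zero = last
  size [] (suc q) = 0
  size (m ∷ ms) zero = m
  size (m ∷ ms) (suc q) = size ms q

-- Given segment
-- lengths Ls and a profile (sizes ms followed by a last size), windows are placed
-- greedily: window q starts 8, 16 or 24 positions after window q-1 (whichever
-- first makes both endpoints good) and is as long as the sizes still to come.
module Construction (Ls : List ℕ) (long : Long Ls) (last : ℕ) where

  open Profile last public

  GoodPair? : ∀ z r → Dec (Good Ls z × Good Ls (z + r))
  GoodPair? z r with Good? Ls z | Good? Ls (z + r)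
  ... | yes g₁ | yes g₂ = yes (g₁ , g₂)
  ... | no ¬g₁ | _ = no (λ g → ¬g₁ (proj₁ g))
  ... | yes _ | no ¬g₂ = no (λ g → ¬g₂ (proj₂ g))

  offset : ℕ → ℕ → ℕ
  offset z r with GoodPair? (8 + z) r | GoodPair? (16 + z) r
  ... | yes _ | _ = 8
  ... | no _ | yes _ = 16
  ... | no _ | no _ = 24

  -- If offsets 8 and 16 fail, offset 24 works: by density, a position that is
  -- not good has good positions 16 and 8 before it.
  offset-good : ∀ z r → 24 + (z + r) < sum Ls →
    8 ≤ offset z r × offset z r ≤ 24 × Good Ls (offset z r + z) × Good Ls (offset z r + z + r)
  offset-good z r bound with GoodPair? (8 + z) r | GoodPair? (16 + z) r
  ... | yes (g₁ , g₂) | _ = ≤-refl , ≤-lit 8 24 , g₁ , g₂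
  ... | no fail₈ | yes (g₁ , g₂) = ≤-lit 8 16 , ≤-lit 16 24 , g₁ , g₂
  ... | no fail₈ | no fail₁₆ =
    ≤-lit 8 24 , ≤-refl , good24 z (z + r) bound₁ bound fail₈ fail₁₆ ,
    good24 (z + r) z bound bound₁ (λ { (g , g') → fail₈ (g' , g) }) (λ { (g , g') → fail₁₆ (g' , g) })
    where
    bound₁ : 24 + z < sum Ls
    bound₁ = ≤-<-trans (+-monoʳ-≤ 24 (m≤m+n z r)) bound
    before : ∀ z → 24 + z < sum Ls → ¬ Good Ls (24 + z) → Good Ls (8 + z) × Good Ls (16 + z)
    before z z<N ¬g with Good-dense Ls long (8 + z) (24 + z) (+-monoˡ-≤ z (≤-lit 16 24)) ≤-refl z<N
                       | Good-dense Ls long (16 + z) (24 + z) ≤-refl (+-monoˡ-≤ z (≤-lit 24 32)) z<N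
    ... | inj₂ g | _ = ⊥-elim (¬g g)
    ... | _ | inj₂ g = ⊥-elim (¬g g)
    ... | inj₁ g₈ | inj₁ g₁₆ = g₈ , g₁₆
    good24 : ∀ z z' → 24 + z < sum Ls → 24 + z' < sum Ls →
      ¬ (Good Ls (8 + z) × Good Ls (8 + z')) → ¬ (Good Ls (16 + z) × Good Ls (16 + z')) → Good Ls (24 + z)
    good24 z z' z<N z'<N fail₈ fail₁₆ with Good? Ls (24 + z)
    ... | yes g = g
    ... | no ¬g with before z z<N ¬g
                   | Good-dense Ls long (8 + z') (16 + z') ≤-refl (+-monoˡ-≤ z' (≤-lit 16 24))
                       (≤-<-trans (+-monoˡ-≤ z' (≤-lit 16 24)) z'<N)
    ...   | g₈ , _ | inj₁ g' = ⊥-elim (fail₈ (g₈ , g'))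
    ...   | _ , g₁₆ | inj₂ g' = ⊥-elim (fail₁₆ (g₁₆ , g'))

  build : ℕ → List ℕ → Windows
  build x [] = []
  build x (m ∷ ms) = let d = offset x (span ms) in (d + x , d + x + span ms) ∷ build (d + x) ms

  length-build : ∀ x ms → length (build x ms) ≡ length ms
  length-build x [] = refl
  length-build x (m ∷ ms) = cong suc (length-build (offset x (span ms) + x) ms)

  room : ∀ x m ms → 50 ≤ m → x + span (m ∷ ms) ≤ sum Ls → 24 + (x + span ms) < sum Ls
  room x m ms 50≤m bound =
    ≤-trans (+-monoˡ-≤ (x + span ms) (≤-trans (≤-lit 25 50) 50≤m)) (≤-trans (≤-reflexive (+-exchange m x (span ms))) bound)

  nested-build : ∀ x ms → All (50 ≤_) ms → 50 ≤ last → x + span ms ≤ sum Ls →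
    Nested Ls x (x + span ms) (build x ms)
  nested-build x [] _ _ _ = tt
  nested-build x (m ∷ ms) (50≤m ∷ sizes) 50≤last bound
    with offset-good x (span ms) (room x m ms 50≤m bound)
  ... | 8≤d , d≤24 , g₁ , g₂ =
    +-monoˡ-≤ x 8≤d ,
    ≤-trans (+-monoˡ-≤ (d + x) (≤-trans 50≤last (span≥last ms))) (≤-reflexive (+-comm (span ms) (d + x))) ,
    end+8 , g₁ , g₂ ,
    nested-build (d + x) ms sizes 50≤last (≤-trans (m≤n+m _ 8) (≤-trans end+8 bound))
    where
    d = offset x (span ms)
    end+8 : 8 + (d + x + span ms) ≤ x + (m + span ms)
    end+8 = ≤-trans (≤-reflexive (cong (8 +_) (+-assoc d x (span ms))))
              (≤-trans (+-monoˡ-≤ (x + span ms) (≤-trans (+-monoʳ-≤ 8 d≤24) (≤-trans (≤-lit 32 50) 50≤m)))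
                (≤-reflexive (+-exchange m x (span ms))))

  -- Among the span ms positions after x, exactly size ms q carry label q:
  -- label 0 fills the d positions before the first window and the m - d
  -- positions after it, and inside it the labels are those of the inner
  -- windows, raised by one.
  count-build : ∀ x ms → All (50 ≤_) ms → x + span ms ≤ sum Ls → ∀ q →
    sumBelow (span ms) (λ i → ind (eqℕ (label (build x ms) (x + i)) q)) ≡ size ms q
  count-build x [] _ _ zero = sumBelow-one last _ (λ _ _ → refl)
  count-build x [] _ _ (suc q) = sumBelow-zero last _ (λ _ _ → refl)
  count-build x (m ∷ ms) (50≤m ∷ sizes) bound q = counts q
    where
    R = span ms
    d = offset x R
    e = m ∸ d
    ws' = build (d + x) ms
    ws = (d + x , d + x + R) ∷ ws'
    d≤m : d ≤ m
    d≤m = ≤-trans (proj₁ (proj₂ (offset-good x R (room x m ms 50≤m bound)))) (≤-trans (≤-lit 24 50) 50≤m)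
    layout : m + R ≡ d + (R + e)
    layout = trans (cong (_+ R) (sym (m+[n∸m]≡n d≤m))) (trans (+-assoc d e R) (cong (d +_) (+-comm e R)))
    shift : ∀ i → x + (d + i) ≡ d + x + i
    shift i = trans (sym (+-assoc x d i)) (cong (_+ i) (+-comm x d))
    before : ∀ i → i < d → label ws (x + i) ≡ 0
    before i i<d = label-before (d + x) (d + x + R) ws' (x + i) (≤-trans (+-monoʳ-< x i<d) (≤-reflexive (+-comm x d)))
    inside : ∀ i → i < R → label ws (x + (d + i)) ≡ suc (label ws' (d + x + i))
    inside i i<R =
      trans (label-inside (d + x) (d + x + R) ws' (x + (d + i))
               (≤-trans (m≤m+n (d + x) i) (≤-reflexive (sym (shift i))))
               (≤-trans (s≤s (≤-reflexive (shift i))) (+-monoʳ-< (d + x) i<R)))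
            (cong (λ z → suc (label ws' z)) (shift i))
    after : ∀ i → label ws (x + (d + (R + i))) ≡ 0
    after i = label-after (d + x) (d + x + R) ws' _
                (≤-trans (m≤m+n (d + x + R) i) (≤-reflexive (sym (trans (shift (R + i)) (sym (+-assoc (d + x) R i))))))
    h : ℕ → ℕ → ℕ
    h q i = ind (eqℕ (label ws (x + i)) q)
    three-parts : ∀ q → sumBelow (m + R) (h q) ≡
      sumBelow d (h q) + (sumBelow R (λ i → h q (d + i)) + sumBelow e (λ i → h q (d + (R + i))))
    three-parts q = trans (cong (λ z → sumBelow z (h q)) layout)
      (trans (sumBelow-split d (R + e) (h q)) (cong (sumBelow d (h q) +_) (sumBelow-split R e (λ i → h q (d + i)))))
    bound' : d + x + R ≤ sum Ls
    bound' = ≤-trans (≤-reflexive (trans (+-assoc d x R) (+-exchange d x R)))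
               (≤-trans (+-monoʳ-≤ x (+-monoˡ-≤ R d≤m)) bound)
    0≢1+ : ∀ {k} → eqℕ 0 (suc k) ≡ false
    0≢1+ {k} = eqℕ-false {0} {suc k} (λ ())
    counts : ∀ q → sumBelow (m + R) (h q) ≡ size (m ∷ ms) q
    counts zero = begin
      sumBelow (m + R) (h 0)
        ≡⟨ three-parts 0 ⟩
      sumBelow d (h 0) + (sumBelow R (λ i → h 0 (d + i)) + sumBelow e (λ i → h 0 (d + (R + i))))
        ≡⟨ cong₂ _+_ (sumBelow-one d _ (λ i i<d → cong (λ z → ind (eqℕ z 0)) (before i i<d)))
             (cong₂ _+_ (sumBelow-zero R _ (λ i i<R → cong (λ z → ind (eqℕ z 0)) (inside i i<R)))
                        (sumBelow-one e _ (λ i _ → cong (λ z → ind (eqℕ z 0)) (after i)))) ⟩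
      d + (0 + e)
        ≡⟨ m+[n∸m]≡n d≤m ⟩
      m ∎
      where open ≡-Reasoning
    counts (suc q) = begin
      sumBelow (m + R) (h (suc q))
        ≡⟨ three-parts (suc q) ⟩
      sumBelow d (h (suc q)) + (sumBelow R (λ i → h (suc q) (d + i)) + sumBelow e (λ i → h (suc q) (d + (R + i))))
        ≡⟨ cong₂ _+_ (sumBelow-zero d _ (λ i i<d → cong ind (trans (cong (λ z → eqℕ z (suc q)) (before i i<d)) (0≢1+ {q}))))
             (cong₂ _+_ (sumBelow-cong R (λ i i<R → cong ind (trans (cong (λ z → eqℕ z (suc q)) (inside i i<R)) (eqℕ-suc _ q))))
                        (sumBelow-zero e _ (λ i _ → cong ind (trans (cong (λ z → eqℕ z (suc q)) (after i)) (0≢1+ {q}))))) ⟩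
      0 + (sumBelow R (λ i → ind (eqℕ (label ws' (d + x + i)) q)) + 0)
        ≡⟨ +-identityʳ _ ⟩
      sumBelow R (λ i → ind (eqℕ (label ws' (d + x + i)) q))
        ≡⟨ count-build (d + x) ms sizes bound' q ⟩
      size ms q ∎
      where open ≡-Reasoning

module Labelling (Ls : List ℕ) (long : Long Ls) (ws : Windows) (nest : Nested Ls 0 (sum Ls) ws) where

  N : ℕ
  N = sum Ls

  step≤2 : ∀ u v → u < v → v ≤ 2 + u → Step ws u v
  step≤2 = step Ls 0 N ws nest

  leftCut-good : ∀ q → q < length ws → Good Ls (leftCut ws q)
  leftCut-good q q<len = proj₁ (cuts-good Ls 0 N ws nest q q<len)

  rightCut-good : ∀ q → q < length ws → Good Ls (rightCut ws q)
  rightCut-good q q<len = proj₂ (cuts-good Ls 0 N ws nest q q<len)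

  step-close : ∀ u v → Step ws u v → label ws u ≤ suc (label ws v) × label ws v ≤ suc (label ws u)
  step-close u v (flat e) = ≤-trans (≤-reflexive e) (n≤1+n _) , ≤-trans (≤-reflexive (sym e)) (n≤1+n _)
  step-close u v (up q _ e₁ e₂ _ _) rewrite e₁ | e₂ = ≤-trans (n≤1+n q) (n≤1+n _) , ≤-refl
  step-close u v (down q _ e₁ e₂ _ _) rewrite e₁ | e₂ = ≤-refl , ≤-trans (n≤1+n q) (n≤1+n _)

  labels-close : ∀ p p' → MAdj Ls p p' → label ws p ≤ suc (label ws p')
  labels-close p .(2 + p) (inj₁ (_ , refl)) =
    proj₁ (step-close p (2 + p) (step≤2 p (2 + p) (s≤s (n≤1+n p)) ≤-refl))
  labels-close .(2 + p') p' (inj₂ (inj₁ (_ , refl))) =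
    proj₂ (step-close p' (2 + p') (step≤2 p' (2 + p') (s≤s (n≤1+n p')) ≤-refl))
  labels-close p .(suc p) (inj₂ (inj₂ (inj₁ (_ , refl)))) =
    proj₁ (step-close p (suc p) (step≤2 p (suc p) ≤-refl (n≤1+n _)))
  labels-close .(suc p') p' (inj₂ (inj₂ (inj₂ (_ , refl)))) =
    proj₂ (step-close p' (suc p') (step≤2 p' (suc p') ≤-refl (n≤1+n _)))

  -- Edges of length 1 never change the label: they cannot jump over a good cut.
  E1-flat : ∀ s → E1 Ls s → label ws s ≡ label ws (suc s)
  E1-flat s e1 with step≤2 s (suc s) ≤-refl (n≤1+n _)
  ... | flat e = e
  ... | up q q<len _ _ l₁ l₂ = ⊥-elim (E1-notGood Ls long s e1 (subst (Good Ls) (≤-antisym l₂ l₁) (leftCut-good q q<len)))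
  ... | down q q<len _ _ l₁ l₂ = ⊥-elim (E1-notGood Ls long s e1 (subst (Good Ls) (≤-antisym l₂ l₁) (rightCut-good q q<len)))

  Jump : ℕ → ℕ → ℕ → Set
  Jump x y lo = (x ≡ lo × y ≡ 2 + lo) ⊎ (x ≡ 2 + lo × y ≡ lo)

  Crossing : ℕ → ℕ → Set
  Crossing x y = Σ ℕ λ lo → Σ ℕ λ c → IsCut ws c × lo < c × c ≤ 2 + lo × Jump x y lo

  step-cut : ∀ lo → Step ws lo (2 + lo) → label ws lo ≢ label ws (2 + lo) →
    Σ ℕ λ c → IsCut ws c × lo < c × c ≤ 2 + lo
  step-cut lo (flat e) ne = ⊥-elim (ne e)
  step-cut lo (up q q<len _ _ l₁ l₂) _ = leftCut ws q , (q , q<len , inj₁ refl) , l₁ , l₂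
  step-cut lo (down q q<len _ _ l₁ l₂) _ = rightCut ws q , (q , q<len , inj₂ refl) , l₁ , l₂

  crossing : ∀ x y → MAdj Ls x y → label ws x ≢ label ws y → Crossing x y
  crossing x .(2 + x) (inj₁ (_ , refl)) ne with step-cut x (step≤2 x (2 + x) (s≤s (n≤1+n x)) ≤-refl) ne
  ... | c , isCut , l₁ , l₂ = x , c , isCut , l₁ , l₂ , inj₁ (refl , refl)
  crossing .(2 + y) y (inj₂ (inj₁ (_ , refl))) ne with step-cut y (step≤2 y (2 + y) (s≤s (n≤1+n y)) ≤-refl) (λ e → ne (sym e))
  ... | c , isCut , l₁ , l₂ = y , c , isCut , l₁ , l₂ , inj₂ (refl , refl)
  crossing x .(suc x) (inj₂ (inj₂ (inj₁ (e1 , refl)))) ne = ⊥-elim (ne (E1-flat x e1))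
  crossing .(suc y) y (inj₂ (inj₂ (inj₂ (e1 , refl)))) ne = ⊥-elim (ne (sym (E1-flat y e1)))

  jump-near : ∀ x y lo c → Jump x y lo → lo < c → c ≤ 2 + lo → x ≤ suc c × c ≤ 2 + x
  jump-near x y lo c (inj₁ (refl , _)) l₁ l₂ = ≤-trans (<⇒≤ l₁) (n≤1+n c) , l₂
  jump-near x y lo c (inj₂ (refl , _)) l₁ l₂ = s≤s l₁ , ≤-trans l₂ (m≤n+m _ 2)

  two-jumps : ∀ lo lo' c → lo < c → c ≤ 2 + lo → lo' < c → c ≤ 2 + lo' → lo ≢ lo' →
    (lo' ≡ suc lo × c ≡ 2 + lo) ⊎ (lo ≡ suc lo' × c ≡ 2 + lo')
  two-jumps lo lo' c a₁ a₂ b₁ b₂ ne with between lo c a₁ a₂ | between lo' c b₁ b₂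
  ... | inj₁ e₁ | inj₁ e₂ = ⊥-elim (ne (suc-injective (trans (sym e₁) e₂)))
  ... | inj₁ e₁ | inj₂ e₂ = inj₂ (suc-injective (trans (sym e₁) e₂) , e₂)
  ... | inj₂ e₁ | inj₁ e₂ = inj₁ (suc-injective (trans (sym e₂) e₁) , e₁)
  ... | inj₂ e₁ | inj₂ e₂ = ⊥-elim (ne (suc-injective (suc-injective (trans (sym e₁) e₂))))

  same-jump : ∀ x y u v lo → Jump x y lo → Jump u v lo → (u ≡ x × v ≡ y) ⊎ (u ≡ y × v ≡ x)
  same-jump x y u v lo (inj₁ (refl , refl)) (inj₁ (refl , refl)) = inj₁ (refl , refl)
  same-jump x y u v lo (inj₁ (refl , refl)) (inj₂ (refl , refl)) = inj₂ (refl , refl)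
  same-jump x y u v lo (inj₂ (refl , refl)) (inj₁ (refl , refl)) = inj₂ (refl , refl)
  same-jump x y u v lo (inj₂ (refl , refl)) (inj₂ (refl , refl)) = inj₁ (refl , refl)

  noE1-near : ∀ c → Good Ls c → ∀ z → c ≤ 2 + z → z ≤ suc c → ¬ E1 Ls z
  noE1-near c g z h₁ h₂ = proj₂ (Good-near Ls c g z h₁ h₂)

  -- The edges {lo, lo+2} and {lo+1, lo+3} over the good cut lo+2 do not touch:
  -- their ends are 1 or 3 apart, and edges of length 1 do not occur there.
  apart : ∀ x y u v lo → Good Ls (2 + lo) → Jump x y lo → Jump u v (suc lo) → ¬ (u ≡ x ⊎ MAdj Ls x u)
  apart x y u v lo g (inj₁ (refl , _)) (inj₁ (refl , _)) (inj₁ e) = 1+k+n≢n 0 lo e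
  apart x y u v lo g (inj₁ (refl , _)) (inj₁ (refl , _)) (inj₂ a) =
    noE1-near (2 + lo) g lo ≤-refl (m≤n+m lo 3) (MAdj-1 Ls lo a)
  apart x y u v lo g (inj₁ (refl , _)) (inj₂ (refl , _)) (inj₁ e) = 1+k+n≢n 2 lo e
  apart x y u v lo g (inj₁ (refl , _)) (inj₂ (refl , _)) (inj₂ a) = MAdj-3 Ls lo a
  apart x y u v lo g (inj₂ (refl , _)) (inj₁ (refl , _)) (inj₁ e) = 1+k+n≢n 0 (suc lo) (sym e)
  apart x y u v lo g (inj₂ (refl , _)) (inj₁ (refl , _)) (inj₂ a) =
    noE1-near (2 + lo) g (suc lo) (n≤1+n _) (m≤n+m _ 2) (MAdj-1' Ls (suc lo) a)
  apart x y u v lo g (inj₂ (refl , _)) (inj₂ (refl , _)) (inj₁ e) = 1+k+n≢n 0 (2 + lo) e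
  apart x y u v lo g (inj₂ (refl , _)) (inj₂ (refl , _)) (inj₂ a) =
    noE1-near (2 + lo) g (2 + lo) (m≤n+m _ 2) (n≤1+n _) (MAdj-1 Ls (2 + lo) a)

  apart' : ∀ x y u v lo → Good Ls (2 + lo) → Jump x y (suc lo) → Jump u v lo → ¬ (u ≡ x ⊎ MAdj Ls x u)
  apart' x y u v lo g (inj₁ (refl , _)) (inj₁ (refl , _)) (inj₁ e) = 1+k+n≢n 0 lo (sym e)
  apart' x y u v lo g (inj₁ (refl , _)) (inj₁ (refl , _)) (inj₂ a) =
    noE1-near (2 + lo) g lo ≤-refl (m≤n+m lo 3) (MAdj-1' Ls lo a)
  apart' x y u v lo g (inj₁ (refl , _)) (inj₂ (refl , _)) (inj₁ e) = 1+k+n≢n 0 (suc lo) e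
  apart' x y u v lo g (inj₁ (refl , _)) (inj₂ (refl , _)) (inj₂ a) =
    noE1-near (2 + lo) g (suc lo) (n≤1+n _) (m≤n+m _ 2) (MAdj-1 Ls (suc lo) a)
  apart' x y u v lo g (inj₂ (refl , _)) (inj₁ (refl , _)) (inj₁ e) = 1+k+n≢n 2 lo (sym e)
  apart' x y u v lo g (inj₂ (refl , _)) (inj₁ (refl , _)) (inj₂ a) = MAdj-3' Ls lo a
  apart' x y u v lo g (inj₂ (refl , _)) (inj₂ (refl , _)) (inj₁ e) = 1+k+n≢n 0 (2 + lo) (sym e)
  apart' x y u v lo g (inj₂ (refl , _)) (inj₂ (refl , _)) (inj₂ a) =
    noE1-near (2 + lo) g (2 + lo) (m≤n+m _ 2) (n≤1+n _) (MAdj-1' Ls (2 + lo) a)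

  same-cut : ∀ x y u v lo lo' c → Jump x y lo → Jump u v lo' → lo < c → c ≤ 2 + lo → lo' < c → c ≤ 2 + lo' →
    Good Ls c → (u ≡ x ⊎ MAdj Ls x u) → (u ≡ x × v ≡ y) ⊎ (u ≡ y × v ≡ x)
  same-cut x y u v lo lo' c j j' l₁ l₂ l₁' l₂' g touch with lo ≟ℕ lo'
  ... | yes refl = same-jump x y u v lo j j'
  ... | no ne with two-jumps lo lo' c l₁ l₂ l₁' l₂' ne
  ...   | inj₁ (refl , refl) = ⊥-elim (apart x y u v lo g j j' touch)
  ...   | inj₂ (refl , refl) = ⊥-elim (apart' x y u v lo' g j j' touch)

  touch-near : ∀ x u → (u ≡ x ⊎ MAdj Ls x u) → u ≤ 2 + x × x ≤ 2 + u
  touch-near x .x (inj₁ refl) = m≤n+m x 2 , m≤n+m x 2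
  touch-near x u (inj₂ a) = MAdj-near Ls x u a

  -- Their cuts are at most 5
  -- apart, hence equal, since distinct cuts are 8 apart.
  induced-matching : ∀ x y u v → MAdj Ls x y → label ws x ≢ label ws y → MAdj Ls u v → label ws u ≢ label ws v →
    (u ≡ x ⊎ MAdj Ls x u) → (u ≡ x × v ≡ y) ⊎ (u ≡ y × v ≡ x)
  induced-matching x y u v axy nxy auv nuv touch with crossing x y axy nxy | crossing u v auv nuv
  ... | lo , c , cut , l₁ , l₂ , j | lo' , c' , cut' , l₁' , l₂' , j' =
    same-cut x y u v lo lo' c j j' l₁ l₂ (subst (lo' <_) (sym c≡c') l₁') (subst (_≤ 2 + lo') (sym c≡c') l₂')
      (IsCut-good Ls 0 N ws nest c cut) touch
    where
    near = touch-near x u touch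
    nx = jump-near x y lo c j l₁ l₂
    nu = jump-near u v lo' c' j' l₁' l₂'
    c'≤c+5 : c' ≤ 5 + c
    c'≤c+5 = ≤-trans (proj₂ nu) (+-monoʳ-≤ 2 (≤-trans (proj₁ near) (+-monoʳ-≤ 2 (proj₁ nx))))
    c≤c'+5 : c ≤ 5 + c'
    c≤c'+5 = ≤-trans (proj₂ nx) (+-monoʳ-≤ 2 (≤-trans (proj₂ near) (+-monoʳ-≤ 2 (proj₁ nu))))
    c≡c' : c ≡ c'
    c≡c' with <-cmp c c'
    ... | tri≈ _ e _ = e
    ... | tri< c<c' _ _ = ⊥-elim (1+k+n≰n 2 (5 + c) (≤-trans (cuts-apart Ls 0 N ws nest c c' cut cut' c<c') c'≤c+5))
    ... | tri> _ _ c'<c = ⊥-elim (1+k+n≰n 2 (5 + c') (≤-trans (cuts-apart Ls 0 N ws nest c' c cut' cut c'<c) c≤c'+5))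

  weight : ℕ → ℕ → ℕ → ℕ
  weight q u v = ind (eqℕ (label ws u) q) * ind (eqℕ (label ws v) (suc q))

  eq-q-and-1+q : ∀ X q → ind (eqℕ X q) * ind (eqℕ X (suc q)) ≡ 0
  eq-q-and-1+q X q with X ≟ℕ q
  ... | no _ = refl
  ... | yes refl rewrite eqℕ-false {X} {suc X} (λ e → 1+k+n≢n 0 X (sym e)) = refl

  eq-swapped : ∀ q' q → ind (eqℕ (suc q') q) * ind (eqℕ q' (suc q)) ≡ 0
  eq-swapped q' q with suc q' ≟ℕ q
  ... | no _ = refl
  ... | yes refl rewrite eqℕ-false {q'} {2 + q'} (λ e → 1+k+n≢n 1 q' (sym e)) = refl

  -- A step of length 2 touching the left cut c of window q goes up from q:
  -- it has weight 1, and it is an edge since c is good.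
  weight-at-leftCut : ∀ q → q < length ws → ∀ s → s < leftCut ws q → leftCut ws q ≤ 2 + s →
    ind (e2? Ls s) * weight q s (2 + s) ≡ 1
  weight-at-leftCut q q<len s s<c c≤s+2
    with leftCut-crossing Ls 0 N ws nest q q<len s (2 + s) s<c c≤s+2 ≤-refl
  ... | e₁ , e₂ rewrite e₁ | e₂ | eqℕ-true {q} refl | eqℕ-true {suc q} refl
    | dec-true (E2? Ls s) (proj₁ (Good-near Ls _ (leftCut-good q q<len) s c≤s+2 (≤-trans (<⇒≤ s<c) (n≤1+n _)))) = refl

  weight-at-rightCut : ∀ q → q < length ws → ∀ s → s < rightCut ws q → rightCut ws q ≤ 2 + s →
    ind (e2? Ls s) * weight q (2 + s) s ≡ 1
  weight-at-rightCut q q<len s s<c c≤s+2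
    with rightCut-crossing Ls 0 N ws nest q q<len s (2 + s) s<c c≤s+2 ≤-refl
  ... | e₁ , e₂ rewrite e₁ | e₂ | eqℕ-true {q} refl | eqℕ-true {suc q} refl
    | dec-true (E2? Ls s) (proj₁ (Good-near Ls _ (rightCut-good q q<len) s c≤s+2 (≤-trans (<⇒≤ s<c) (n≤1+n _)))) = refl

  weight-off-leftCut : ∀ q s → suc s ≢ leftCut ws q → 2 + s ≢ leftCut ws q → weight q s (2 + s) ≡ 0
  weight-off-leftCut q s ne₁ ne₂ with step≤2 s (2 + s) (s≤s (n≤1+n s)) ≤-refl
  ... | flat e rewrite e = eq-q-and-1+q (label ws (2 + s)) q
  ... | down q' _ e₁ e₂ _ _ rewrite e₁ | e₂ = eq-swapped q' q
  ... | up q' _ e₁ e₂ l₁ l₂ rewrite e₁ | e₂ = other-window q' l₁ l₂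
    where
    other-window : ∀ q' → s < leftCut ws q' → leftCut ws q' ≤ 2 + s →
      ind (eqℕ q' q) * ind (eqℕ (suc q') (suc q)) ≡ 0
    other-window q' l₁ l₂ with q' ≟ℕ q
    ... | no _ = refl
    ... | yes refl with between s (leftCut ws q') l₁ l₂
    ...   | inj₁ e = ⊥-elim (ne₁ (sym e))
    ...   | inj₂ e = ⊥-elim (ne₂ (sym e))

  weight-off-rightCut : ∀ q s → suc s ≢ rightCut ws q → 2 + s ≢ rightCut ws q → weight q (2 + s) s ≡ 0
  weight-off-rightCut q s ne₁ ne₂ with step≤2 s (2 + s) (s≤s (n≤1+n s)) ≤-refl
  ... | flat e rewrite e = eq-q-and-1+q (label ws (2 + s)) q
  ... | up q' _ e₁ e₂ _ _ rewrite e₁ | e₂ = eq-swapped q' q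
  ... | down q' _ e₁ e₂ l₁ l₂ rewrite e₁ | e₂ = other-window q' l₁ l₂
    where
    other-window : ∀ q' → s < rightCut ws q' → rightCut ws q' ≤ 2 + s →
      ind (eqℕ q' q) * ind (eqℕ (suc q') (suc q)) ≡ 0
    other-window q' l₁ l₂ with q' ≟ℕ q
    ... | no _ = refl
    ... | yes refl with between s (rightCut ws q') l₁ l₂
    ...   | inj₁ e = ⊥-elim (ne₁ (sym e))
    ...   | inj₂ e = ⊥-elim (ne₂ (sym e))

  touching-sum : ∀ (w : ℕ → ℕ) c → 2 ≤ c → c ≤ N →
    (∀ s → s < c → c ≤ 2 + s → w s ≡ 1) → (∀ s → suc s ≢ c → 2 + s ≢ c → w s ≡ 0) →
    sumBelow N w ≡ 2
  touching-sum w c 2≤c c≤N at off = begin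
    sumBelow N w                                                          ≡⟨ sumBelow-cong N (λ s _ → pointwise s) ⟩
    sumBelow N (λ s → ind (eqℕ (1 + s) c) + ind (eqℕ (2 + s) c))          ≡⟨ sumBelow-+ N _ _ ⟩
    sumBelow N (λ s → ind (eqℕ (1 + s) c)) + sumBelow N (λ s → ind (eqℕ (2 + s) c))
      ≡⟨ cong₂ _+_ (sumBelow-count-shift 1 N c (≤-trans (s≤s z≤n) 2≤c) (s≤s c≤N))
                   (sumBelow-count-shift 2 N c 2≤c (s≤s (≤-trans c≤N (n≤1+n N)))) ⟩
    2 ∎
    where
    open ≡-Reasoning
    pointwise : ∀ s → w s ≡ ind (eqℕ (suc s) c) + ind (eqℕ (2 + s) c)
    pointwise s with suc s ≟ℕ c
    ... | yes refl rewrite eqℕ-false {2 + s} {suc s} (1+k+n≢n 0 (suc s)) = at s ≤-refl (n≤1+n _)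
    ... | no ne₁ with 2 + s ≟ℕ c
    ...   | yes refl = at s (s≤s (n≤1+n s)) ≤-refl
    ...   | no ne₂ = off s ne₁ ne₂

  cut-bounds : ∀ c → Good Ls c → 2 ≤ c × c ≤ N
  cut-bounds c g = ≤-trans (≤-lit 2 4) (Good-4≤ Ls c g) , ≤-trans (m≤n+m c 4) (Good-bound Ls c g)

  up-steps : ∀ q → q < length ws → sumBelow N (λ s → ind (e2? Ls s) * weight q s (2 + s)) ≡ 2
  up-steps q q<len = touching-sum _ c (proj₁ bounds) (proj₂ bounds) (weight-at-leftCut q q<len)
    (λ s ne₁ ne₂ → trans (cong (ind (e2? Ls s) *_) (weight-off-leftCut q s ne₁ ne₂)) (*-zeroʳ (ind (e2? Ls s))))
    where
    c = leftCut ws q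
    bounds = cut-bounds c (leftCut-good q q<len)

  down-steps : ∀ q → q < length ws → sumBelow N (λ s → ind (e2? Ls s) * weight q (2 + s) s) ≡ 2
  down-steps q q<len = touching-sum _ c (proj₁ bounds) (proj₂ bounds) (weight-at-rightCut q q<len)
    (λ s ne₁ ne₂ → trans (cong (ind (e2? Ls s) *_) (weight-off-rightCut q s ne₁ ne₂)) (*-zeroʳ (ind (e2? Ls s))))
    where
    c = rightCut ws q
    bounds = cut-bounds c (rightCut-good q q<len)

  E1-weightless : ∀ q s → ind (e1? Ls s) * weight q s (suc s) ≡ 0 × ind (e1? Ls s) * weight q (suc s) s ≡ 0
  E1-weightless q s with E1? Ls s
  ... | no _ = refl , refl
  ... | yes e1 rewrite E1-flat s e1 =
    trans (+-identityʳ _) (eq-q-and-1+q (label ws (suc s)) q) , trans (+-identityʳ _) (eq-q-and-1+q (label ws (suc s)) q)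

  -- (iv) For every window q, exactly four edges go from label q to label q+1:
  -- two jump over its left cut, two over its right cut.
  four-edges : ∀ (b : ℕ → ℕ → Bool) →
    (∀ p p' → p < N → p' < N → b p p' ≡ true → MAdj Ls p p') →
    (∀ p p' → p < N → p' < N → MAdj Ls p p' → b p p' ≡ true) →
    ∀ q → q < length ws →
    sumBelow N (λ p → sumBelow N (λ p' → ind (b p p' ∧ (eqℕ (label ws p) q ∧ eqℕ (label ws p') (suc q))))) ≡ 4
  four-edges b b⇒MAdj MAdj⇒b q q<len = begin
    sumBelow N (λ p → sumBelow N (λ p' → ind (b p p' ∧ (eqℕ (label ws p) q ∧ eqℕ (label ws p') (suc q)))))
      ≡⟨ sumBelow-cong N (λ p _ → sumBelow-cong N (λ p' _ →
           trans (ind-∧ (b p p') _) (cong (ind (b p p') *_) (ind-∧ (eqℕ (label ws p) q) _)))) ⟩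
    sumBelow N (λ p → sumBelow N (λ p' → ind (b p p') * weight q p p'))
      ≡⟨ sum-over-edges (weight q) ⟩
    sumBelow N (λ s → ind (e2? Ls s) * weight q s (2 + s)) + (sumBelow N (λ s → ind (e2? Ls s) * weight q (2 + s) s)
      + (sumBelow N (λ s → ind (e1? Ls s) * weight q s (1 + s)) + sumBelow N (λ s → ind (e1? Ls s) * weight q (1 + s) s)))
      ≡⟨ cong₂ _+_ (up-steps q q<len) (cong₂ _+_ (down-steps q q<len)
           (cong₂ _+_ (sumBelow-zero N _ (λ s _ → proj₁ (E1-weightless q s)))
                      (sumBelow-zero N _ (λ s _ → proj₂ (E1-weightless q s))))) ⟩
    4 ∎
    where
    open ≡-Reasoning
    open EdgeSum Ls b b⇒MAdj MAdj⇒b using (sum-over-edges)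

-- The zigzag order of a cycle of length K: position o of its segment holds
-- the cycle vertex zigzag K o, where 0 ↦ 0, 2r+1 ↦ r+1, 2r+2 ↦ K-(r+1), i.e.
-- c₀, c₁, c_{K-1}, c₂, c_{K-2}, ….  Consecutive cycle vertices then sit at
-- positions 2 apart, except for the two edges at the ends of the segment.
module Zigzag where

  data ZigView : ℕ → Set where
    start : ZigView 0
    odd   : ∀ r → ZigView (suc (r + r))
    even  : ∀ r → ZigView (suc (suc (r + r)))

  suc-double : ∀ r → suc r + suc r ≡ suc (suc (r + r))
  suc-double r = cong suc (+-suc r r)

  zigView : ∀ o → ZigView o
  zigView zero = start
  zigView (suc zero) = odd 0
  zigView (suc (suc o)) with zigView o
  ... | start = even 0
  ... | odd r = subst ZigView (cong suc (suc-double r)) (odd (suc r))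
  ... | even r = subst ZigView (cong (λ z → suc (suc z)) (suc-double r)) (even (suc r))

  zigzag : ℕ → ℕ → ℕ
  zigzag K o with zigView o
  ... | start = 0
  ... | odd r = suc r
  ... | even r = K ∸ suc r

  double-injective : ∀ a b → a + a ≡ b + b → a ≡ b
  double-injective zero zero e = refl
  double-injective (suc a) (suc b) e =
    cong suc (double-injective a b (suc-injective (trans (sym (+-suc a a)) (trans (suc-injective e) (+-suc b b)))))

  odd≢even : ∀ a b → suc (a + a) ≢ b + b
  odd≢even zero (suc b) e = 0≢1+n (trans (suc-injective e) (+-suc b b))
  odd≢even (suc a) (suc b) e =
    odd≢even a b (suc-injective (trans (sym (cong suc (+-suc a a))) (trans (suc-injective e) (+-suc b b))))

  zigzag-odd : ∀ K r → zigzag K (suc (r + r)) ≡ suc r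
  zigzag-odd K r = go (suc (r + r)) refl
    where
    go : ∀ o → o ≡ suc (r + r) → zigzag K o ≡ suc r
    go o e with zigView o
    ... | start = ⊥-elim (0≢1+n e)
    ... | odd r' = cong suc (double-injective r' r (suc-injective e))
    ... | even r' = ⊥-elim (odd≢even r' r (suc-injective e))

  zigzag-even : ∀ K r → zigzag K (suc (suc (r + r))) ≡ K ∸ suc r
  zigzag-even K r = go (suc (suc (r + r))) refl
    where
    go : ∀ o → o ≡ suc (suc (r + r)) → zigzag K o ≡ K ∸ suc r
    go o e with zigView o
    ... | start = ⊥-elim (0≢1+n e)
    ... | odd r' = ⊥-elim (odd≢even r' (suc r) (trans e (sym (suc-double r))))
    ... | even r' = cong (λ z → K ∸ suc z) (double-injective r' r (suc-injective (suc-injective e)))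

  zigzag-odd′ : ∀ K r → zigzag K (3 + (r + r)) ≡ 2 + r
  zigzag-odd′ K r = trans (cong (zigzag K) (sym (cong suc (suc-double r)))) (zigzag-odd K (suc r))

  zigzag-even′ : ∀ K r → zigzag K (4 + (r + r)) ≡ K ∸ (2 + r)
  zigzag-even′ K r = trans (cong (zigzag K) (sym (cong (λ z → suc (suc z)) (suc-double r)))) (zigzag-even K (suc r))

  zigzag< : ∀ K o → o < K → zigzag K o < K
  zigzag< K o o<K with zigView o
  ... | start = o<K
  ... | odd r = ≤-trans (s≤s (s≤s (m≤m+n r r))) o<K
  ... | even r = ∸-monoʳ-< {K} {suc r} {0} (s≤s z≤n) (≤-trans (s≤s (m≤m+n r r)) (≤-trans (n≤1+n _) (≤-trans (n≤1+n _) o<K)))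

  odd≢evenPos : ∀ K r r' → suc (r + r) < K → suc (suc (r' + r')) < K → suc r ≢ K ∸ suc r'
  odd≢evenPos K r r' h h' e = n≮n r (≤-<-trans r≤r' r'<r)
    where
    r'+1≤K : suc r' ≤ K
    r'+1≤K = ≤-trans (s≤s (m≤m+n r' r')) (≤-trans (n≤1+n _) (≤-trans (n≤1+n _) h'))
    K≡ : K ≡ suc (suc (r + r'))
    K≡ = trans (sym (m∸n+n≡m r'+1≤K)) (trans (cong (_+ suc r') (sym e)) (cong suc (+-suc r r')))
    r≤r' : r ≤ r'
    r≤r' = +-cancelˡ-≤ r _ _ (≤-pred (≤-pred (subst (suc (suc (r + r)) ≤_) K≡ h)))
    r'<r : r' < r
    r'<r = +-cancelʳ-< r' r' r (≤-pred (≤-pred (subst (suc (suc (suc (r' + r'))) ≤_) K≡ h')))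

  zigzag-injective : ∀ K o o' → o < K → o' < K → zigzag K o ≡ zigzag K o' → o ≡ o'
  zigzag-injective K o o' h h' e with zigView o | zigView o'
  ... | start | start = refl
  ... | start | odd r' = ⊥-elim (0≢1+n e)
  ... | start | even r' = ⊥-elim (n≮n 0 (subst (0 <_) (sym e) (m<n⇒0<n∸m (≤-trans (s≤s (s≤s (m≤m+n r' r'))) (≤-trans (n≤1+n _) h')))))
  ... | odd r | start = ⊥-elim (0≢1+n (sym e))
  ... | odd r | odd r' = cong (λ z → suc (z + z)) (suc-injective e)
  ... | odd r | even r' = ⊥-elim (odd≢evenPos K r r' h h' e)
  ... | even r | start = ⊥-elim (n≮n 0 (subst (0 <_) e (m<n⇒0<n∸m (≤-trans (s≤s (s≤s (m≤m+n r r))) (≤-trans (n≤1+n _) h)))))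
  ... | even r | odd r' = ⊥-elim (odd≢evenPos K r' r h' h (sym e))
  ... | even r | even r' = cong (λ z → suc (suc (z + z))) (suc-injective (∸-cancelˡ-≡ (r+1≤K r h) (r+1≤K r' h') e))
    where
    r+1≤K : ∀ r → suc (suc (r + r)) < K → suc r ≤ K
    r+1≤K r h = ≤-trans (s≤s (m≤m+n r r)) (≤-trans (n≤1+n _) (≤-trans (n≤1+n _) h))

  zigzag-surjective : ∀ K i → i < K → Σ ℕ λ o → o < K × zigzag K o ≡ i
  zigzag-surjective K zero i<K = 0 , i<K , refl
  zigzag-surjective K (suc r) i<K with suc (r + r) <? K
  ... | yes o<K = suc (r + r) , o<K , zigzag-odd K r
  ... | no o≮K with m≤n⇒∃[o]m+o≡n i<K
  ...   | t , refl = suc (suc (t + t)) , o<K , trans (zigzag-even (suc (suc r) + t) t) (m+n∸n≡m (suc r) t)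
    where
    t<r : t < r
    t<r = +-cancelˡ-< r t r (≤-pred (≮⇒≥ o≮K))
    o<K : suc (suc (t + t)) < suc (suc r) + t
    o<K = s≤s (s≤s (+-monoˡ-< t t<r))

  CycleStep : ℕ → ℕ → ℕ → Set
  CycleStep K i j = (suc i < K × j ≡ suc i) ⊎ (suc i ≡ K × j ≡ 0)

  parity : ∀ o → (o ≡ 0) ⊎ Σ ℕ (λ r → o ≡ suc (r + r)) ⊎ Σ ℕ (λ r → o ≡ suc (suc (r + r)))
  parity o with zigView o
  ... | start = inj₁ refl
  ... | odd r = inj₂ (inj₁ (r , refl))
  ... | even r = inj₂ (inj₂ (r , refl))

  zigzag-edge : ∀ K o o' → 3 ≤ K → SegEdge K o o' →
    CycleStep K (zigzag K o) (zigzag K o') ⊎ CycleStep K (zigzag K o') (zigzag K o)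
  zigzag-edge K o o' 3≤K (inj₁ (o+3≤K , refl)) with parity o
  ... | inj₁ refl = inj₂ (inj₂ (m+[n∸m]≡n (≤-trans (s≤s z≤n) 3≤K) , refl))
  ... | inj₂ (inj₁ (r , refl)) rewrite zigzag-odd K r | zigzag-odd′ K r =
    inj₁ (inj₁ (≤-trans (s≤s (s≤s (s≤s (m≤m+n r r)))) (≤-trans (n≤1+n _) o+3≤K) , refl))
  ... | inj₂ (inj₂ (r , refl)) rewrite zigzag-even K r | zigzag-even′ K r
    with m≤n⇒∃[o]m+o≡n (≤-trans (s≤s (s≤s (m≤m+n r r))) (≤-trans (n≤1+n _) (≤-trans (n≤1+n _) (≤-trans (n≤1+n _) o+3≤K))))
  ...   | t , refl rewrite m+n∸m≡n (suc (suc r)) t | cong (_∸ r) (sym (+-suc r t)) | m+n∸m≡n r (suc t) =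
    inj₂ (inj₁ (s≤s (s≤s (m≤n+m t r)) , refl))
  zigzag-edge K .0 .1 3≤K (inj₂ ((_ , inj₁ refl) , refl)) = inj₁ (inj₁ (≤-trans (s≤s (s≤s z≤n)) 3≤K , refl))
  zigzag-edge K o .(suc o) 3≤K (inj₂ ((_ , inj₂ refl) , refl)) with parity o
  ... | inj₁ refl = ⊥-elim (1+k+n≰n 0 2 3≤K)
  ... | inj₂ (inj₁ (r , refl)) rewrite zigzag-odd (3 + (r + r)) r | zigzag-even (3 + (r + r)) r
                                     | m+n∸n≡m (suc (suc r)) r =
    inj₁ (inj₁ (s≤s (s≤s (s≤s (m≤m+n r r))) , refl))
  ... | inj₂ (inj₂ (r , refl)) rewrite zigzag-even (4 + (r + r)) r | zigzag-odd′ (4 + (r + r)) r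
                                     | m+n∸n≡m (suc (suc (suc r))) r =
    inj₂ (inj₁ (s≤s (s≤s (s≤s (s≤s (m≤m+n r r)))) , refl))

open Zigzag

module CyclicOrder where

  cycPred : ∀ {k} → Fin k → Fin k
  cycPred {suc k} Fin.zero = fromℕ k
  cycPred {suc k} (Fin.suc i) = inject₁ i

  toℕ-cycSucc : ∀ {k} (i : Fin (suc k)) →
    (suc (toℕ i) < suc k × toℕ (cycSucc i) ≡ suc (toℕ i)) ⊎ (toℕ i ≡ k × toℕ (cycSucc i) ≡ 0)
  toℕ-cycSucc {k} i with suc (toℕ i) <? suc k
  ... | yes p = inj₁ (p , toℕ-fromℕ< p)
  ... | no ¬p = inj₂ (≤-antisym (≤-pred (toℕ<n i)) (≮⇒≥ (λ z → ¬p (s≤s z))) , refl)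

  cycSucc-fromℕ< : ∀ {k} m (p : m < suc k) (q : suc m < suc k) → cycSucc (fromℕ< p) ≡ fromℕ< q
  cycSucc-fromℕ< {k} m p q with toℕ-cycSucc (fromℕ< p)
  ... | inj₁ (_ , e) = toℕ-injective (trans e (trans (cong suc (toℕ-fromℕ< p)) (sym (toℕ-fromℕ< q))))
  ... | inj₂ (e , _) = ⊥-elim (n≮n (suc k) (subst (λ z → suc z < suc k) (trans (sym (toℕ-fromℕ< p)) e) q))

  cycSucc-last : ∀ {k} (i : Fin (suc k)) → suc (toℕ i) ≡ suc k → cycSucc i ≡ Fin.zero
  cycSucc-last {k} i e with toℕ-cycSucc i
  ... | inj₁ (p , _) = ⊥-elim (n≮n (suc k) (subst (_< suc k) e p))
  ... | inj₂ (_ , e₂) = toℕ-injective e₂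

  cycSucc-cycPred : ∀ {k} (i : Fin k) → cycSucc (cycPred i) ≡ i
  cycSucc-cycPred {suc k} Fin.zero = cycSucc-last (fromℕ k) (cong suc (toℕ-fromℕ k))
  cycSucc-cycPred {suc k} (Fin.suc i) with toℕ-cycSucc (inject₁ i)
  ... | inj₁ (_ , e) = toℕ-injective (trans e (cong suc (toℕ-inject₁ i)))
  ... | inj₂ (e , _) = ⊥-elim (n≮n k (subst (_< k) (trans (sym (toℕ-inject₁ i)) e) (toℕ<n i)))

  cycSucc≢cycPred : ∀ {k} (i : Fin k) → 3 ≤ k → cycSucc i ≢ cycPred i
  cycSucc≢cycPred {suc k} Fin.zero 3≤k eq with toℕ-cycSucc (Fin.zero {k})
  ... | inj₁ (_ , e) =
    1+k+n≰n 0 1 (≤-trans (≤-pred 3≤k) (≤-reflexive (trans (sym (toℕ-fromℕ k)) (trans (cong toℕ (sym eq)) e))))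
  ... | inj₂ (e , _) = 1+k+n≰n 1 0 (≤-trans (≤-pred 3≤k) (≤-reflexive (sym e)))
  cycSucc≢cycPred {suc k} (Fin.suc j) 3≤k eq with toℕ-cycSucc (Fin.suc j)
  ... | inj₁ (_ , e) = 1+k+n≢n 1 (toℕ j) (trans (sym e) (trans (cong toℕ eq) (toℕ-inject₁ j)))
  ... | inj₂ (e , e₂) =
    1+k+n≰n 0 1 (≤-trans (≤-pred 3≤k) (≤-reflexive (trans (sym e)
      (cong suc (trans (sym (toℕ-inject₁ j)) (trans (cong toℕ (sym eq)) e₂))))))

open CyclicOrder

module CycleStructure (n : ℕ) (G : Graph n) (reg : TwoRegular G) where

  Adj-sym : ∀ {x y} → Adj G x y → Adj G y x
  Adj-sym {x} {y} a = trans (Graph.sym G y x) a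

  three-below : ∀ v y₁ y₂ z → Adj G v y₁ → Adj G v y₂ → y₁ ≢ y₂ → z ≢ y₁ → z ≢ y₂ → Adj G v z → ∀ x →
    ind ⌊ x ≟ y₁ ⌋ + ind ⌊ x ≟ y₂ ⌋ + ind ⌊ x ≟ z ⌋ ≤ ind (adj G v x)
  three-below v y₁ y₂ z a₁ a₂ y₁≢y₂ z≢y₁ z≢y₂ az x with x ≟ y₁ | x ≟ y₂ | x ≟ z
  ... | yes refl | yes refl | _ = ⊥-elim (y₁≢y₂ refl)
  ... | yes refl | no _ | yes refl = ⊥-elim (z≢y₁ refl)
  ... | yes refl | no _ | no _ rewrite a₁ = ≤-refl
  ... | no _ | yes refl | yes refl = ⊥-elim (z≢y₂ refl)
  ... | no _ | yes refl | no _ rewrite a₂ = ≤-refl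
  ... | no _ | no _ | yes refl rewrite az = ≤-refl
  ... | no _ | no _ | no _ = z≤n

  only-two-neighbours : ∀ v y₁ y₂ z → Adj G v y₁ → Adj G v y₂ → y₁ ≢ y₂ → Adj G v z → z ≡ y₁ ⊎ z ≡ y₂
  only-two-neighbours v y₁ y₂ z a₁ a₂ y₁≢y₂ az with z ≟ y₁ | z ≟ y₂
  ... | yes e | _ = inj₁ e
  ... | no _ | yes e = inj₂ e
  ... | no z≢y₁ | no z≢y₂ = ⊥-elim (1+k+n≰n 0 2 (≤-trans three (≤-reflexive degree≡2)))
    where
    degree≡2 : sumFin n (λ x → ind (adj G v x)) ≡ 2
    degree≡2 = trans (sym (count-sumFin n (adj G v))) (reg v)
    three : 3 ≤ sumFin n (λ x → ind (adj G v x))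
    three = ≤-trans (≤-reflexive (sym (trans (sumFin-+ n _ _)
              (cong₂ _+_ (trans (sumFin-+ n _ _) (cong₂ _+_ (sumFin-delta n y₁) (sumFin-delta n y₂))) (sumFin-delta n z)))))
            (sumFin-mono n (three-below v y₁ y₂ z a₁ a₂ y₁≢y₂ z≢y₁ z≢y₂ az))

  record LongCycle : Set where
    field
      len-1 : ℕ
      long : 30 ≤ suc len-1
      vertex : Fin (suc len-1) → Fin n
      isCycle : IsCycle G (suc len-1) vertex
  open LongCycle public

  len : LongCycle → ℕ
  len C = suc (len-1 C)

  len≥3 : (C : LongCycle) → 3 ≤ len C
  len≥3 C = proj₁ (isCycle C)

  vertex-injective : (C : LongCycle) → Injective _≡_ _≡_ (vertex C)
  vertex-injective C = proj₁ (proj₂ (isCycle C))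

  adj-succ : (C : LongCycle) → ∀ i → Adj G (vertex C i) (vertex C (cycSucc i))
  adj-succ C = proj₂ (proj₂ (isCycle C))

  adj-pred : (C : LongCycle) → ∀ i → Adj G (vertex C i) (vertex C (cycPred i))
  adj-pred C i = Adj-sym (subst (λ z → Adj G (vertex C (cycPred i)) (vertex C z)) (cycSucc-cycPred i) (adj-succ C (cycPred i)))

  cycle-neighbour : (C : LongCycle) → ∀ i y → Adj G (vertex C i) y →
    y ≡ vertex C (cycSucc i) ⊎ y ≡ vertex C (cycPred i)
  cycle-neighbour C i y a =
    only-two-neighbours (vertex C i) _ _ y (adj-succ C i) (adj-pred C i)
      (λ e → cycSucc≢cycPred i (len≥3 C) (vertex-injective C e)) a

  OnCycle : LongCycle → Fin n → Set
  OnCycle C y = Σ (Fin (len C)) λ j → vertex C j ≡ y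

  OnCycle? : ∀ C y → Dec (OnCycle C y)
  OnCycle? C y = any? (λ j → vertex C j ≟ y)

  -- A cycle D containing a vertex of C contains its cycle neighbours, hence all
  -- of C: the cycles of a 2-regular graph are its connected components.
  OnCycle-succ : (C D : LongCycle) → ∀ i → OnCycle D (vertex C i) → OnCycle D (vertex C (cycSucc i))
  OnCycle-succ C D i (j , e)
    with cycle-neighbour D j (vertex C (cycSucc i)) (subst (λ z → Adj G z (vertex C (cycSucc i))) (sym e) (adj-succ C i))
  ... | inj₁ e' = cycSucc j , sym e'
  ... | inj₂ e' = cycPred j , sym e'

  OnCycle-pred : (C D : LongCycle) → ∀ i → OnCycle D (vertex C i) → OnCycle D (vertex C (cycPred i))
  OnCycle-pred C D i (j , e)
    with cycle-neighbour D j (vertex C (cycPred i)) (subst (λ z → Adj G z (vertex C (cycPred i))) (sym e) (adj-pred C i))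
  ... | inj₁ e' = cycSucc j , sym e'
  ... | inj₂ e' = cycPred j , sym e'

  OnCycle-down : (C D : LongCycle) → ∀ m (i : Fin (len C)) → toℕ i ≡ m → OnCycle D (vertex C i) → OnCycle D (vertex C Fin.zero)
  OnCycle-down C D zero Fin.zero _ h = h
  OnCycle-down C D (suc m) (Fin.suc j) e h =
    OnCycle-down C D m (inject₁ j) (trans (toℕ-inject₁ j) (suc-injective e)) (OnCycle-pred C D (Fin.suc j) h)

  OnCycle-up : (C D : LongCycle) → ∀ m (p : m < len C) → OnCycle D (vertex C Fin.zero) → OnCycle D (vertex C (fromℕ< p))
  OnCycle-up C D zero p h = h
  OnCycle-up C D (suc m) p h =
    subst (λ z → OnCycle D (vertex C z)) (cycSucc-fromℕ< m (<-trans (n<1+n m) p) p)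
      (OnCycle-succ C D (fromℕ< (<-trans (n<1+n m) p)) (OnCycle-up C D m (<-trans (n<1+n m) p) h))

  OnCycle-all : (C D : LongCycle) → ∀ i → OnCycle D (vertex C i) → ∀ i' → OnCycle D (vertex C i')
  OnCycle-all C D i h i' = subst (λ z → OnCycle D (vertex C z)) (fromℕ<-toℕ i' (toℕ<n i'))
    (OnCycle-up C D (toℕ i') (toℕ<n i') (OnCycle-down C D (toℕ i) i refl h))

  Disjoint : LongCycle → LongCycle → Set
  Disjoint C D = ∀ i j → vertex C i ≢ vertex D j

  PairwiseDisjoint : List LongCycle → Set
  PairwiseDisjoint [] = ⊤
  PairwiseDisjoint (C ∷ Cs) = All (Disjoint C) Cs × PairwiseDisjoint Cs

  Covered : List LongCycle → Fin n → Set
  Covered [] x = ⊥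
  Covered (C ∷ Cs) x = OnCycle C x ⊎ Covered Cs x

  Covered? : ∀ Cs y → Dec (Covered Cs y)
  Covered? [] y = no (λ ())
  Covered? (C ∷ Cs) y with OnCycle? C y | Covered? Cs y
  ... | yes h | _ = yes (inj₁ h)
  ... | no _ | yes h = yes (inj₂ h)
  ... | no ¬h | no ¬h' = no λ { (inj₁ h) → ¬h h ; (inj₂ h) → ¬h' h }

  covered-not-on : ∀ C Cs y → All (Disjoint C) Cs → Covered Cs y → ¬ OnCycle C y
  covered-not-on C (D ∷ Ds) y (disj ∷ _) (inj₁ (j , e)) (i , e') = disj i j (trans e' (sym e))
  covered-not-on C (D ∷ Ds) y (_ ∷ disj) (inj₂ h) on = covered-not-on C Ds y disj h on

  lengths : List LongCycle → List ℕ
  lengths [] = []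
  lengths (C ∷ Cs) = len C ∷ lengths Cs

  lengths-long : ∀ Cs → Long (lengths Cs)
  lengths-long [] = []
  lengths-long (C ∷ Cs) = long C ∷ lengths-long Cs

  -- If every vertex lies on a long cycle, the vertex set is a disjoint union of
  -- long cycles: scan the vertices and add the cycle through each vertex not
  -- yet covered.  A new cycle is disjoint from the previous ones, since sharing
  -- a vertex would make it one of them.
  module Decomposition (onCycle : ∀ x → OnCycleOfLengthAtLeast G 30 x) where

    cycleThrough : (x : Fin n) → Σ LongCycle λ C → OnCycle C x
    cycleThrough x with onCycle x
    ... | suc k , s≤s 29≤k , c , isC , i , e =
      record { len-1 = k ; long = s≤s 29≤k ; vertex = c ; isCycle = isC } , i , e

    disjoint-new : ∀ x (C : LongCycle) → OnCycle C x → ∀ Cs → ¬ Covered Cs x → All (Disjoint C) Cs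
    disjoint-new x C on [] _ = []
    disjoint-new x C (i , e) (D ∷ Ds) ¬cov =
      (λ i' j e' → ¬cov (inj₁ (subst (OnCycle D) e (OnCycle-all C D i' (j , sym e') i))))
      ∷ disjoint-new x C (i , e) Ds (λ h → ¬cov (inj₂ h))

    add : Fin n → List LongCycle → List LongCycle
    add x Cs with Covered? Cs x
    ... | yes _ = Cs
    ... | no _ = proj₁ (cycleThrough x) ∷ Cs

    add-disjoint : ∀ x Cs → PairwiseDisjoint Cs → PairwiseDisjoint (add x Cs)
    add-disjoint x Cs pd with Covered? Cs x
    ... | yes _ = pd
    ... | no ¬cov = disjoint-new x (proj₁ (cycleThrough x)) (proj₂ (cycleThrough x)) Cs ¬cov , pd

    add-mono : ∀ x Cs y → Covered Cs y → Covered (add x Cs) y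
    add-mono x Cs y h with Covered? Cs x
    ... | yes _ = h
    ... | no _ = inj₂ h

    add-covers : ∀ x Cs → Covered (add x Cs) x
    add-covers x Cs with Covered? Cs x
    ... | yes h = h
    ... | no _ = inj₁ (proj₂ (cycleThrough x))

    scan : ∀ m → m ≤ n → List LongCycle
    scan zero _ = []
    scan (suc m) m<n = add (fromℕ< m<n) (scan m (≤-trans (n≤1+n m) m<n))

    scan-disjoint : ∀ m m≤n → PairwiseDisjoint (scan m m≤n)
    scan-disjoint zero _ = tt
    scan-disjoint (suc m) m<n = add-disjoint (fromℕ< m<n) (scan m _) (scan-disjoint m _)

    scan-covers : ∀ m m≤n (y : Fin n) → toℕ y < m → Covered (scan m m≤n) y
    scan-covers (suc m) m<n y y<m+1 with m≤n⇒m<n∨m≡n (≤-pred y<m+1)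
    ... | inj₁ y<m = add-mono (fromℕ< m<n) (scan m _) y (scan-covers m _ y y<m)
    ... | inj₂ y≡m = subst (Covered (scan (suc m) m<n)) (toℕ-injective (trans (toℕ-fromℕ< m<n) (sym y≡m)))
                       (add-covers (fromℕ< m<n) (scan m _))

    cycles : List LongCycle
    cycles = scan n ≤-refl

    cycles-disjoint : PairwiseDisjoint cycles
    cycles-disjoint = scan-disjoint n ≤-refl

    cycles-cover : ∀ y → Covered cycles y
    cycles-cover y = scan-covers n ≤-refl y (toℕ<n y)

  -- Laying out a list of cycles on positions: position p of the segment of C
  -- holds the vertex of C with index zigzag (len C) p.  The vertex d fills the
  -- positions beyond the last segment.
  module Layout (d : Fin n) where

    vertexAt : List LongCycle → ℕ → Fin n
    vertexAt [] p = d
    vertexAt (C ∷ Cs) p with p <? len C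
    ... | yes p<len = vertex C (fromℕ< (zigzag< (len C) p p<len))
    ... | no _ = vertexAt Cs (p ∸ len C)

    vertexAt-here : ∀ C Cs p (p<len : p < len C) → vertexAt (C ∷ Cs) p ≡ vertex C (fromℕ< (zigzag< (len C) p p<len))
    vertexAt-here C Cs p p<len with p <? len C
    ... | yes _ = refl
    ... | no p≮len = ⊥-elim (p≮len p<len)

    vertexAt-there : ∀ C Cs p → vertexAt (C ∷ Cs) (len C + p) ≡ vertexAt Cs p
    vertexAt-there C Cs p with len C + p <? len C
    ... | yes h = ⊥-elim (1+c+[a+b]≰a (len C) p 0 h)
    ... | no _ = cong (vertexAt Cs) (m+n∸m≡n (len C) p)

    vertexAt-covered : ∀ Cs p → p < sum (lengths Cs) → Covered Cs (vertexAt Cs p)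
    vertexAt-covered (C ∷ Cs) p p<N with p <? len C
    ... | yes _ = inj₁ (_ , refl)
    ... | no p≮len with ≤⇒shift (len C) p (≮⇒≥ p≮len)
    ...   | q , refl = inj₂ (subst (Covered Cs) (sym (cong (vertexAt Cs) (m+n∸m≡n (len C) q)))
                         (vertexAt-covered Cs q (+-cancelˡ-< (len C) q _ p<N)))

    vertexAt-injective : ∀ Cs → PairwiseDisjoint Cs → ∀ p p' → p < sum (lengths Cs) → p' < sum (lengths Cs) →
      vertexAt Cs p ≡ vertexAt Cs p' → p ≡ p'
    vertexAt-injective (C ∷ Cs) (disj , pd) p p' p<N p'<N e with len C ≤? p | len C ≤? p'
    ... | no p≱ | no p'≱ =
      zigzag-injective (len C) p p' h h' (trans (sym (toℕ-fromℕ< (zigzag< (len C) p h)))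
        (trans (cong toℕ (vertex-injective C (trans (sym (vertexAt-here C Cs p h)) (trans e (vertexAt-here C Cs p' h')))))
               (toℕ-fromℕ< (zigzag< (len C) p' h'))))
      where
      h = ≰⇒> p≱
      h' = ≰⇒> p'≱
    ... | no p≱ | yes p'≥ with ≤⇒shift (len C) p' p'≥
    ...   | q' , refl = ⊥-elim (covered-not-on C Cs _ disj (vertexAt-covered Cs q' (+-cancelˡ-< (len C) q' _ p'<N))
                          (_ , trans (sym (vertexAt-here C Cs p (≰⇒> p≱))) (trans e (vertexAt-there C Cs q'))))
    vertexAt-injective (C ∷ Cs) (disj , pd) p p' p<N p'<N e | yes p≥ | no p'≱ with ≤⇒shift (len C) p p≥
    ...   | q , refl = ⊥-elim (covered-not-on C Cs _ disj (vertexAt-covered Cs q (+-cancelˡ-< (len C) q _ p<N))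
                         (_ , trans (sym (vertexAt-here C Cs p' (≰⇒> p'≱))) (trans (sym e) (vertexAt-there C Cs q))))
    vertexAt-injective (C ∷ Cs) (disj , pd) p p' p<N p'<N e | yes p≥ | yes p'≥
      with ≤⇒shift (len C) p p≥ | ≤⇒shift (len C) p' p'≥
    ...   | q , refl | q' , refl =
      cong (len C +_) (vertexAt-injective Cs pd q q' (+-cancelˡ-< (len C) q _ p<N) (+-cancelˡ-< (len C) q' _ p'<N)
        (trans (sym (vertexAt-there C Cs q)) (trans e (vertexAt-there C Cs q'))))

    vertexAt-surjective : ∀ Cs y → Covered Cs y → Σ ℕ λ p → p < sum (lengths Cs) × vertexAt Cs p ≡ y
    vertexAt-surjective (C ∷ Cs) y (inj₁ (j , e)) with zigzag-surjective (len C) (toℕ j) (toℕ<n j)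
    ... | o , o<len , zo = o , ≤-trans o<len (m≤m+n (len C) _) ,
          trans (vertexAt-here C Cs o o<len)
                (trans (cong (vertex C) (toℕ-injective (trans (toℕ-fromℕ< (zigzag< (len C) o o<len)) zo))) e)
    vertexAt-surjective (C ∷ Cs) y (inj₂ h) with vertexAt-surjective Cs y h
    ... | p , p<N , e = len C + p , +-monoʳ-< (len C) p<N , trans (vertexAt-there C Cs p) e

    cycleStep-adj : ∀ C i j (i<len : i < len C) (j<len : j < len C) → CycleStep (len C) i j →
      Adj G (vertex C (fromℕ< i<len)) (vertex C (fromℕ< j<len))
    cycleStep-adj C i .(suc i) i<len j<len (inj₁ (_ , refl)) =
      subst (λ z → Adj G (vertex C (fromℕ< i<len)) (vertex C z)) (cycSucc-fromℕ< i i<len j<len) (adj-succ C (fromℕ< i<len))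
    cycleStep-adj C i .0 i<len j<len (inj₂ (last , refl)) =
      subst (λ z → Adj G (vertex C (fromℕ< i<len)) (vertex C z))
        (cycSucc-last (fromℕ< i<len) (trans (cong suc (toℕ-fromℕ< i<len)) last)) (adj-succ C (fromℕ< i<len))

    segEdge-adj : ∀ C o o' (o<len : o < len C) (o'<len : o' < len C) → SegEdge (len C) o o' →
      Adj G (vertex C (fromℕ< (zigzag< (len C) o o<len))) (vertex C (fromℕ< (zigzag< (len C) o' o'<len)))
    segEdge-adj C o o' o<len o'<len e with zigzag-edge (len C) o o' (len≥3 C) e
    ... | inj₁ s = cycleStep-adj C _ _ (zigzag< (len C) o o<len) (zigzag< (len C) o' o'<len) s
    ... | inj₂ s = Adj-sym (cycleStep-adj C _ _ (zigzag< (len C) o' o'<len) (zigzag< (len C) o o<len) s)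

    MAdj⇒Adj : ∀ Cs p p' → p < sum (lengths Cs) → p' < sum (lengths Cs) → MAdj (lengths Cs) p p' →
      Adj G (vertexAt Cs p) (vertexAt Cs p')
    MAdj⇒Adj (C ∷ Cs) p p' p<N p'<N m with MAdj-split (len C) (lengths Cs) p p' m
    ... | inj₁ (h , h' , inj₁ e) rewrite vertexAt-here C Cs p h | vertexAt-here C Cs p' h' = segEdge-adj C p p' h h' e
    ... | inj₁ (h , h' , inj₂ e) rewrite vertexAt-here C Cs p h | vertexAt-here C Cs p' h' =
      Adj-sym (segEdge-adj C p' p h' h e)
    ... | inj₂ (x , x' , refl , refl , m') rewrite vertexAt-there C Cs x | vertexAt-there C Cs x' =
      MAdj⇒Adj Cs x x' (+-cancelˡ-< (len C) x _ p<N) (+-cancelˡ-< (len C) x' _ p'<N) m'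

  module Positions (onCycle : ∀ x → OnCycleOfLengthAtLeast G 30 x) (d : Fin n) where
    open Decomposition onCycle
    open Layout d

    Ls : List ℕ
    Ls = lengths cycles

    Ls-long : Long Ls
    Ls-long = lengths-long cycles

    N : ℕ
    N = sum Ls

    at : ℕ → Fin n
    at = vertexAt cycles

    positionOf : (y : Fin n) → Σ ℕ λ p → p < N × at p ≡ y
    positionOf y = vertexAt-surjective cycles y (cycles-cover y)

    at-injective : ∀ p p' → p < N → p' < N → at p ≡ at p' → p ≡ p'
    at-injective = vertexAt-injective cycles cycles-disjoint

    toVertex : Fin N → Fin n
    toVertex p = at (toℕ p)

    toPosition : Fin n → Fin N
    toPosition y = fromℕ< (proj₁ (proj₂ (positionOf y)))

    toPosition-toVertex : ∀ p → toPosition (toVertex p) ≡ p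
    toPosition-toVertex p = toℕ-injective (trans (toℕ-fromℕ< (proj₁ (proj₂ (positionOf (toVertex p)))))
      (at-injective _ _ (proj₁ (proj₂ (positionOf (toVertex p)))) (toℕ<n p) (proj₂ (proj₂ (positionOf (toVertex p))))))

    toVertex-toPosition : ∀ y → toVertex (toPosition y) ≡ y
    toVertex-toPosition y = trans (cong at (toℕ-fromℕ< (proj₁ (proj₂ (positionOf y))))) (proj₂ (proj₂ (positionOf y)))

    positions : Permutation N n
    positions = permutation toVertex toPosition toVertex-toPosition toPosition-toVertex

    MAdj⇒G : ∀ p p' → p < N → p' < N → MAdj Ls p p' → Adj G (at p) (at p')
    MAdj⇒G = MAdj⇒Adj cycles

    -- Conversely, an edge of G at position p goes to one of the two model
    -- neighbours of p, because G is 2-regular.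
    G⇒MAdj : ∀ p p' → p < N → p' < N → Adj G (at p) (at p') → MAdj Ls p p'
    G⇒MAdj p p' p<N p'<N a with twoNeighbours Ls Ls-long p p<N
    ... | q₁ , q₂ , q₁≢q₂ , q₁<N , q₂<N , m₁ , m₂
      with only-two-neighbours (at p) (at q₁) (at q₂) (at p') (MAdj⇒G p q₁ p<N q₁<N m₁) (MAdj⇒G p q₂ p<N q₂<N m₂)
             (λ e → q₁≢q₂ (at-injective q₁ q₂ q₁<N q₂<N e)) a
    ...   | inj₁ e = subst (MAdj Ls p) (sym (at-injective p' q₁ p'<N q₁<N e)) m₁
    ...   | inj₂ e = subst (MAdj Ls p) (sym (at-injective p' q₂ p'<N q₂<N e)) m₂

-- The prescribed sizes n₀,…,n_t as a profile: the list n₀,…,n_{t-1} of window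
-- sizes followed by the last size n_t.
module SizeList where

  initial : ∀ t → (Fin (suc t) → ℕ) → List ℕ
  initial zero ns = []
  initial (suc t) ns = ns Fin.zero ∷ initial t (λ i → ns (Fin.suc i))

  final : ∀ t → (Fin (suc t) → ℕ) → ℕ
  final zero ns = ns Fin.zero
  final (suc t) ns = final t (λ i → ns (Fin.suc i))

  length-initial : ∀ t ns → length (initial t ns) ≡ t
  length-initial zero ns = refl
  length-initial (suc t) ns = cong suc (length-initial t (λ i → ns (Fin.suc i)))

  initial-big : ∀ t ns → (∀ i → 50 ≤ ns i) → All (50 ≤_) (initial t ns)
  initial-big zero ns big = []
  initial-big (suc t) ns big = big Fin.zero ∷ initial-big t (λ i → ns (Fin.suc i)) (λ i → big (Fin.suc i))

  final-big : ∀ t ns → (∀ i → 50 ≤ ns i) → 50 ≤ final t ns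
  final-big zero ns big = big Fin.zero
  final-big (suc t) ns big = final-big t (λ i → ns (Fin.suc i)) (λ i → big (Fin.suc i))

  span-initial : ∀ t ns → Profile.span (final t ns) (initial t ns) ≡ sumFin (suc t) ns
  span-initial zero ns = sym (+-identityʳ (ns Fin.zero))
  span-initial (suc t) ns = cong (ns Fin.zero +_) (span-initial t (λ i → ns (Fin.suc i)))

  size-initial : ∀ t ns i → Profile.size (final t ns) (initial t ns) (toℕ i) ≡ ns i
  size-initial zero ns Fin.zero = refl
  size-initial (suc t) ns Fin.zero = refl
  size-initial (suc t) ns (Fin.suc i) = size-initial t (λ j → ns (Fin.suc j)) i

open SizeList

-- The labelling of the vertices of F: transport the window labelling of the
-- position model along the bijection between positions and vertices.
module Partition (n t : ℕ) (F : Graph n) (reg : TwoRegular F) (onCycle : ∀ x → OnCycleOfLengthAtLeast F 30 x)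
                 (d : Fin n) (ns : Fin (suc t) → ℕ) (total : sumFin (suc t) ns ≡ n) (big : ∀ i → 50 ≤ ns i) where

  open CycleStructure n F reg
  open Positions onCycle d
  open Construction Ls Ls-long (final t ns)

  sizes : List ℕ
  sizes = initial t ns

  span≡N : span sizes ≡ N
  span≡N = trans (span-initial t ns) (trans total (sym (Perm.↔⇒≡ positions)))

  windows : Windows
  windows = build 0 sizes

  nested : Nested Ls 0 N windows
  nested = subst (λ z → Nested Ls 0 z windows) span≡N
             (nested-build 0 sizes (initial-big t ns big) (final-big t ns big) (≤-reflexive span≡N))

  open Labelling Ls Ls-long windows nested hiding (N)

  length-windows : length windows ≡ t
  length-windows = trans (length-build 0 sizes) (length-initial t ns)

  position : Fin n → ℕ
  position x = toℕ (toPosition x)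

  label< : ∀ p → label windows p < suc t
  label< p = s≤s (≤-trans (label≤length windows p) (≤-reflexive length-windows))

  f : Fin n → Fin (suc t)
  f x = fromℕ< (label< (position x))

  toℕ-f : ∀ x → toℕ (f x) ≡ label windows (position x)
  toℕ-f x = toℕ-fromℕ< (label< (position x))

  toℕ-f-at : ∀ (p : Fin N) → toℕ (f (toVertex p)) ≡ label windows (toℕ p)
  toℕ-f-at p = trans (toℕ-f (toVertex p)) (cong (λ z → label windows (toℕ z)) (toPosition-toVertex p))

  at-position : ∀ x → at (position x) ≡ x
  at-position = toVertex-toPosition

  position-injective : ∀ x y → position x ≡ position y → x ≡ y
  position-injective x y e = trans (sym (at-position x)) (trans (cong at e) (at-position y))

  Adj⇒MAdj : ∀ x y → Adj F x y → MAdj Ls (position x) (position y)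
  Adj⇒MAdj x y a = G⇒MAdj (position x) (position y) (toℕ<n _) (toℕ<n _)
                     (subst₂ (Adj F) (sym (at-position x)) (sym (at-position y)) a)

  part-sizes : ∀ i → count n (λ x → ⌊ f x ≟ i ⌋) ≡ ns i
  part-sizes i = begin
    count n (λ x → ⌊ f x ≟ i ⌋)                        ≡⟨ count-sumFin n _ ⟩
    sumFin n (λ x → ind ⌊ f x ≟ i ⌋)                   ≡⟨ sumFin-permute _ positions ⟩
    sumFin N (λ p → ind ⌊ f (toVertex p) ≟ i ⌋)        ≡⟨ sumFin-cong N (λ p → cong ind (trans (eqFin-toℕ _ i)
                                                             (cong (λ z → eqℕ z (toℕ i)) (toℕ-f-at p)))) ⟩
    sumFin N (λ p → has-label (toℕ p))                 ≡⟨ sumFin-toℕ N has-label ⟩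
    sumBelow N has-label                               ≡⟨ cong (λ z → sumBelow z has-label) (sym span≡N) ⟩
    sumBelow (span sizes) has-label                    ≡⟨ count-build 0 sizes (initial-big t ns big) (≤-reflexive span≡N) (toℕ i) ⟩
    size sizes (toℕ i)                                 ≡⟨ size-initial t ns i ⟩
    ns i ∎
    where
    open ≡-Reasoning
    has-label : ℕ → ℕ
    has-label p = ind (eqℕ (label windows p) (toℕ i))

  parts-close : ∀ x y → Adj F x y → toℕ (f x) ≤ suc (toℕ (f y))
  parts-close x y a = subst₂ (λ u w → u ≤ suc w) (sym (toℕ-f x)) (sym (toℕ-f y))
                        (labels-close (position x) (position y) (Adj⇒MAdj x y a))

  cross-matching : CrossEdgesInducedMatching F f
  cross-matching x y u v axy nxy auv nuv touch
    with induced-matching (position x) (position y) (position u) (position v) (Adj⇒MAdj x y axy) (differ nxy)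
           (Adj⇒MAdj u v auv) (differ nuv) (touch′ touch)
    where
    differ : ∀ {a b} → f a ≢ f b → label windows (position a) ≢ label windows (position b)
    differ {a} {b} ne e = ne (toℕ-injective (trans (toℕ-f a) (trans e (sym (toℕ-f b)))))
    touch′ : (u ≡ x ⊎ Adj F x u) → position u ≡ position x ⊎ MAdj Ls (position x) (position u)
    touch′ (inj₁ e) = inj₁ (cong position e)
    touch′ (inj₂ a) = inj₂ (Adj⇒MAdj x u a)
  ... | inj₁ (e₁ , e₂) = inj₁ (position-injective u x e₁ , position-injective v y e₂)
  ... | inj₂ (e₁ , e₂) = inj₂ (position-injective u y e₁ , position-injective v x e₂)

  four-between : ∀ i → suc i < suc t → edgesBetween F f i ≡ 4
  four-between i i+1<t+1 = begin
    edgesBetween F f i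
      ≡⟨ sumFin-cong n (λ x → count-sumFin n _) ⟩
    sumFin n (λ x → sumFin n (λ y → crosses x y))
      ≡⟨ sumFin-permute _ positions ⟩
    sumFin N (λ p → sumFin n (λ y → crosses (toVertex p) y))
      ≡⟨ sumFin-cong N (λ p → sumFin-permute _ positions) ⟩
    sumFin N (λ p → sumFin N (λ p' → crosses (toVertex p) (toVertex p')))
      ≡⟨ sumFin-cong N (λ p → trans (sumFin-cong N (λ p' → cong₂ (λ a a' → ind (b (toℕ p) (toℕ p') ∧ (eqℕ a i ∧ eqℕ a' (suc i))))
                                        (toℕ-f-at p) (toℕ-f-at p')))
                                   (sumFin-toℕ N (crossesAt (toℕ p)))) ⟩
    sumFin N (λ p → sumBelow N (crossesAt (toℕ p)))
      ≡⟨ sumFin-toℕ N (λ a → sumBelow N (crossesAt a)) ⟩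
    sumBelow N (λ a → sumBelow N (crossesAt a))
      ≡⟨ four-edges b G⇒MAdj MAdj⇒G i (subst (i <_) (sym length-windows) (≤-pred i+1<t+1)) ⟩
    4 ∎
    where
    open ≡-Reasoning
    b : ℕ → ℕ → Bool
    b a a' = adj F (at a) (at a')
    crosses : Fin n → Fin n → ℕ
    crosses x y = ind (adj F x y ∧ (eqℕ (toℕ (f x)) i ∧ eqℕ (toℕ (f y)) (suc i)))
    crossesAt : ℕ → ℕ → ℕ
    crossesAt a a' = ind (b a a' ∧ (eqℕ (label windows a) i ∧ eqℕ (label windows a') (suc i)))

-- Lemma 4.13.  For t = 0 there is nothing to do, and n = 0 contradicts
-- n₀ ≥ 50; otherwise the parts are those of Partition (vertex 0 serves as the
-- filler of unused positions).
lemma4p13 : (n t : ℕ) (F : Graph n) → TwoRegular F →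
    (∀ x → OnCycleOfLengthAtLeast F 30 x) →
    (ns : Fin t → ℕ) → sumFin t ns ≡ n → (∀ i → 50 ≤ ns i) →
    Σ (Fin n → Fin t) λ f →
      (∀ i → count n (λ x → ⌊ f x ≟ i ⌋) ≡ ns i)
      × (∀ x y → Adj F x y → toℕ (f x) ≤ suc (toℕ (f y)))
      × CrossEdgesInducedMatching F f
      × (∀ (i : ℕ) → suc i < t → edgesBetween F f i ≡ 4)
lemma4p13 n zero F reg onCycle ns refl big = (λ ()) , (λ ()) , (λ ()) , (λ ()) , (λ _ ())
lemma4p13 zero (suc t) F reg onCycle ns total big =
  ⊥-elim (1+k+n≰n 49 0 (≤-trans (big Fin.zero) (≤-trans (m≤m+n (ns Fin.zero) _) (≤-reflexive total))))
lemma4p13 (suc n) (suc t) F reg onCycle ns total big =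
  f , part-sizes , parts-close , cross-matching , four-between
  where open Partition (suc n) t F reg onCycle Fin.zero ns total big
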